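{- Let $q$ be a prime power, $v\ge1$, and $r\ge 0$ an integer. (i) Let $\{Y_1,\dots,Y_q\}$ be a $q$-sunflower in $\mathbb{F}_q^v$ with $r$-dimensional center $X$, and let $\mathcal{C}=\bigcup_{i=1}^q(Y_i\setminus X)$ (as a set of points). Then $|\mathcal{C}\cap H|\equiv|\mathcal{C}|\pmod{q^r}$ for every hyperplane $H$ of $\mathbb{F}_q^v$. (ii) Let $\{Y_1,\dots,Y_{q+1}\}$ be a $(q+1)$-sunflower in $\mathbb{F}_q^v$ with $r$-dimensional center $X$, and let $\mathcal{C}=X\cup\bigcup_{i=1}^{q+1}(Y_i\setminus X)$ (as a set of points). Then $|\mathcal{C}\cap H|\equiv|\mathcal{C}|\pmod{q^r}$ for every hyperplane $H$ of $\mathbb{F}_q^v$.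
   Context: Subspaces of $\mathbb{F}_q^v$ are identified with their sets of points ($1$-dimensional subspaces they contain); hyperplanes are $(v-1)$-dimensional subspaces and $\mathcal{C}\cap H$ is the set of points of $\mathcal{C}$ in $H$. For a subspace $X$ and an integer $t\ge2$, a $t$-sunflower with center $X$ is a set $\{Y_1,\dots,Y_t\}$ of subspaces with $Y_i\ne X$ for all $i$ and $Y_i\cap Y_j=X$ for $i\ne j$; its petals are the point sets $Y_i\setminus X$. -}

module Defs where

open import Level using (0ℓ)
open import Algebra.Bundles using (CommutativeRing)
open import Data.Nat using (ℕ; zero; suc)
open import Data.Bool using (Bool; true; false; _∧_; not; if_then_else_)
open import Data.Fin using (Fin)
open import Data.Vec using (Vec; []; _∷_; zipWith; map; replicate; foldr)
open import Data.Vec.Relation.Binary.Pointwise.Inductive using (Pointwise)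
open import Data.Vec.Relation.Unary.All using (All)
open import Data.List as L using (List; concatMap; length; filter; allFin)
open import Data.List.Relation.Unary.Any using (Any)
open import Data.Bool.ListAction using (any)
open import Data.List.Relation.Unary.AllPairs using (AllPairs)
open import Data.Product using (Σ; ∃; _×_)
open import Relation.Nullary using (¬_; does)
open import Relation.Binary.Definitions using (Decidable)
open import Relation.Binary.PropositionalEquality using (_≡_)

record FiniteField : Set₁ where
  field
    commRing   : CommutativeRing 0ℓ 0ℓ
  open CommutativeRing commRing public
  field
    1≉0        : ¬ (1# ≈ 0#)
    inverse    : ∀ x → ¬ (x ≈ 0#) → ∃ λ y → x * y ≈ 1#
    _≟_        : Decidable _≈_
    elements   : List Carrier
    complete   : ∀ x → Any (x ≈_) elements
    distinct   : AllPairs (λ a b → ¬ (a ≈ b)) elements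

  order : ℕ
  order = length elements

module Geometry (F : FiniteField) where
  open FiniteField F

  V : ℕ → Set
  V v = Vec Carrier v

  _≋_ : ∀ {v} → V v → V v → Set
  _≋_ = Pointwise _≈_

  0v : ∀ {v} → V v
  0v = replicate _ 0#

  _⊕_ : ∀ {v} → V v → V v → V v
  _⊕_ = zipWith _+_

  _⊙_ : ∀ {v} → Carrier → V v → V v
  a ⊙ x = map (a *_) x

  lincomb : ∀ {v r} → Vec Carrier r → Vec (V v) r → V v
  lincomb [] [] = 0v
  lincomb (c ∷ cs) (b ∷ bs) = (c ⊙ b) ⊕ lincomb cs bs

  allVecs : (v : ℕ) → List (V v)
  allVecs zero    = [] L.∷ L.[]
  allVecs (suc v) = concatMap (λ a → L.map (a ∷_) (allVecs v)) elements

  -- Points (1-dimensional subspaces) of F_q^v are represented by their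
  -- unique normalized spanning vector: first nonzero coordinate equals 1.
  isPoint : ∀ {v} → V v → Bool
  isPoint []       = false
  isPoint (x ∷ xs) = if does (x ≟ 0#) then isPoint xs else does (x ≟ 1#)

  #points : ∀ v → (V v → Bool) → ℕ
  #points v P = length (filter (λ x → Data.Bool._≟_ (isPoint x ∧ P x) true) (allVecs v))

  record Subspace (v : ℕ) : Set where
    field
      mem      : V v → Bool
      resp     : ∀ {x y} → x ≋ y → mem x ≡ mem y
      zero∈    : mem 0v ≡ true
      +-closed : ∀ {x y} → mem x ≡ true → mem y ≡ true → mem (x ⊕ y) ≡ true
      ·-closed : ∀ a {x} → mem x ≡ true → mem (a ⊙ x) ≡ true
  open Subspace public

  HasDim : ∀ {v} → Subspace v → ℕ → Set
  HasDim {v} S r = Σ (Vec (V v) r) λ b →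
      (∀ c → mem S (lincomb c b) ≡ true)
    × (∀ x → mem S x ≡ true → ∃ λ c → x ≋ lincomb c b)
    × (∀ c → lincomb c b ≋ 0v → All (_≈ 0#) c)

  IsHyperplane : ∀ {v} → Subspace v → Set
  IsHyperplane {v} H = HasDim H (v Data.Nat.∸ 1)

  IsSunflower : ∀ {v} t → (Fin t → Subspace v) → Subspace v → Set
  IsSunflower {v} t Y X =
      (∀ i → ¬ (∀ (p : V v) → isPoint p ≡ true → mem (Y i) p ≡ mem X p))
    × (∀ i j → ¬ (i ≡ j) → ∀ (p : V v) → isPoint p ≡ true →
         (mem (Y i) p ∧ mem (Y j) p) ≡ mem X p)

  petals : ∀ {v} t → (Fin t → Subspace v) → Subspace v → V v → Bool
  petals t Y X p = any (λ i → mem (Y i) p ∧ not (mem X p)) (allFin t)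

  petalsAndCenter : ∀ {v} t → (Fin t → Subspace v) → Subspace v → V v → Bool
  petalsAndCenter t Y X p = mem X p Data.Bool.∨ petals t Y X p

-- Work with vectors instead of points: a set of points that avoids 0 and is closed under nonzero
-- scalars has q - 1 times as many vectors as points, and #points (C ∖ H) = |C| - |C ∩ H|.
-- For a petal Y ⊋ X, q^r divides the number of vectors in Y ∖ H. If X ⊆ H, then Y ∖ H is a union of
-- cosets of X. Otherwise choose x₀ ∈ X ∖ H: every subspace S ∋ x₀ is the disjoint union of the q
-- translates (S ∩ H) + d x₀, so |S| = q |S ∩ H| and |S ∖ H| = (q - 1) |S ∩ H|; and Y is a union of
-- cosets of ⟨y, X⟩ for y ∈ Y ∖ X, so q^(r+1) divides |Y|, whence q^r divides |Y ∩ H| and |Y ∖ H|.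
-- The same case split shows that q^r divides q |X ∖ H|.
-- The petals Y_i ∖ X are pairwise disjoint, so Σ_i |Y_i ∖ H| = t |X ∖ H| + (q - 1) · #points (C ∖ H).
-- For t = q this gives q^r ∣ (q - 1) · #points (C ∖ H); for t = q + 1 the extra
-- |X ∖ H| = (q - 1) · #points (X ∖ H) adds the centre to C. As q - 1 is prime to q, q^r divides
-- #points (C ∖ H).

module Submission where

open import Level using (0ℓ)
open import Defs
open import Data.Bool using (Bool; true; false; _∧_; _∨_; not; if_then_else_)
open import Data.Nat using (ℕ; zero; suc)
open import Data.Fin using (Fin)
import Data.Fin as Fin
open import Data.List using (List; []; _∷_)
open import Data.Vec using (Vec; []; _∷_)
open import Data.List.Relation.Unary.All using (All; []; _∷_)
open import Data.List.Relation.Unary.AllPairs using (AllPairs; []; _∷_)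
open import Data.List.Relation.Unary.Any using (Any; here; there)
open import Data.Product using (∃; _×_; _,_; proj₁; proj₂)
open import Data.Sum using (_⊎_; inj₁; inj₂)
open import Data.Empty using (⊥; ⊥-elim)
open import Function using (_∘_; Congruent; Equivalence)
open import Relation.Nullary using (¬_)
open import Relation.Binary.Bundles using (Setoid)
open import Relation.Binary.PropositionalEquality as ≡ using (_≡_; _≢_; module ≡-Reasoning)

module Counting where

  open import Data.Bool using (T; T?)
  open import Data.Bool.Properties using (∧-zeroʳ; ∧-identityʳ; ∧-distribˡ-∨; ∧-distribʳ-∨; T-≡)
  open import Data.Bool.ListAction using (any)
  open import Data.Nat using (_+_; _*_; _≤_; z≤n; s≤s)
  open import Data.Nat.Properties using (+-suc; *-zeroʳ; m≤n⇒m≤1+n; suc-injective; <⇒≢)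
  open import Data.Nat.Divisibility using (_∣_; _∣0; ∣m∣n⇒∣m+n)
  open import Data.Nat.Tactic.RingSolver using (solve-∀)
  open import Data.Nat.ListAction using (sum)
  open import Data.List using (_++_; map; concatMap; length; filter; filterᵇ)
  open import Data.List.Relation.Unary.All using (universal)
  open import Data.Product using (map₂)
  open ≡ using (refl; sym; trans; cong; cong₂; subst)

  false≢true : false ≢ true
  false≢true ()

  module _ {A : Set} where

    count : (A → Bool) → List A → ℕ
    count P []       = 0
    count P (x ∷ xs) = if P x then suc (count P xs) else count P xs

    count-cong : ∀ {P Q : A → Bool} → (∀ x → P x ≡ Q x) → ∀ xs → count P xs ≡ count Q xs
    count-cong P≗Q []       = refl
    count-cong P≗Q (x ∷ xs) rewrite P≗Q x = cong (λ n → if _ then suc n else n) (count-cong P≗Q xs)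

    count-++ : ∀ (P : A → Bool) (xs ys : List A) → count P (xs ++ ys) ≡ count P xs + count P ys
    count-++ P []       ys = refl
    count-++ P (x ∷ xs) ys with P x
    ... | true  = cong suc (count-++ P xs ys)
    ... | false = count-++ P xs ys

    count-true : ∀ (xs : List A) → count (λ _ → true) xs ≡ length xs
    count-true []       = refl
    count-true (x ∷ xs) = cong suc (count-true xs)

    count-split : ∀ (P Q : A → Bool) xs →
                  count P xs ≡ count (λ x → P x ∧ Q x) xs + count (λ x → P x ∧ not (Q x)) xs
    count-split P Q []       = refl
    count-split P Q (x ∷ xs) with P x | Q x
    ... | true  | true  = cong suc (count-split P Q xs)
    ... | true  | false = trans (cong suc (count-split P Q xs)) (sym (+-suc _ _))
    ... | false | _     = count-split P Q xs

    count-∨ : ∀ (P Q : A → Bool) xs → (∀ x → (P x ∧ Q x) ≡ false) →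
              count (λ x → P x ∨ Q x) xs ≡ count P xs + count Q xs
    count-∨ P Q []       disjoint = refl
    count-∨ P Q (x ∷ xs) disjoint with P x | Q x | disjoint x
    ... | true  | true  | ()
    ... | true  | false | _ = cong suc (count-∨ P Q xs disjoint)
    ... | false | true  | _ = trans (cong suc (count-∨ P Q xs disjoint)) (sym (+-suc _ _))
    ... | false | false | _ = count-∨ P Q xs disjoint

    count-filterᵇ : ∀ (Q P : A → Bool) xs → count P (filterᵇ Q xs) ≡ count (λ x → Q x ∧ P x) xs
    count-filterᵇ Q P []       = refl
    count-filterᵇ Q P (x ∷ xs) with Q x
    ... | true  = cong (λ n → if P x then suc n else n) (count-filterᵇ Q P xs)
    ... | false = count-filterᵇ Q P xs

    length-filter-≟true : ∀ (P : A → Bool) xs →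
      length (filter (λ x → Data.Bool._≟_ (P x) true) xs) ≡ count P xs
    length-filter-≟true P []       = refl
    length-filter-≟true P (x ∷ xs) with P x
    ... | true  = cong suc (length-filter-≟true P xs)
    ... | false = length-filter-≟true P xs

    count≤length : ∀ (P : A → Bool) xs → count P xs ≤ length xs
    count≤length P []       = z≤n
    count≤length P (x ∷ xs) with P x
    ... | true  = s≤s (count≤length P xs)
    ... | false = m≤n⇒m≤1+n (count≤length P xs)

    count≡length⇒All : ∀ (P : A → Bool) xs → count P xs ≡ length xs → All (λ x → P x ≡ true) xs
    count≡length⇒All P []       _ = []
    count≡length⇒All P (x ∷ xs) e with P x in Px
    ... | true  = Px ∷ count≡length⇒All P xs (suc-injective e)
    ... | false = ⊥-elim (<⇒≢ (s≤s (count≤length P xs)) e)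

    count-none : ∀ (P : A → Bool) xs → All (λ x → P x ≡ false) xs → count P xs ≡ 0
    count-none P []       []           = refl
    count-none P (x ∷ xs) (Px≡f ∷ all) rewrite Px≡f = count-none P xs all

    none⊎witness : ∀ (P : A → Bool) xs → All (λ x → P x ≡ false) xs ⊎ Any (λ x → P x ≡ true) xs
    none⊎witness P []       = inj₁ []
    none⊎witness P (x ∷ xs) with P x in Px | none⊎witness P xs
    ... | true  | _        = inj₂ (here Px)
    ... | false | inj₁ all = inj₁ (Px ∷ all)
    ... | false | inj₂ any = inj₂ (there any)

  module _ {A B : Set} where

    count-concatMap : ∀ (P : A → Bool) (f : B → List A) {k bs} → All (λ b → count P (f b) ≡ k) bs →
                      count P (concatMap f bs) ≡ length bs * k
    count-concatMap P f {bs = []}     []            = refl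
    count-concatMap P f {bs = b ∷ bs} (fb≡k ∷ fbs≡k) =
      trans (count-++ P (f b) (concatMap f bs)) (cong₂ _+_ fb≡k (count-concatMap P f fbs≡k))

    count-map : ∀ (P : A → Bool) (f : B → A) xs → count P (map f xs) ≡ count (P ∘ f) xs
    count-map P f []       = refl
    count-map P f (x ∷ xs) = cong (λ n → if P (f x) then suc n else n) (count-map P f xs)

  module _ {I : Set} where

    sum-map-affine : ∀ a k (g h : I → ℕ) is → (∀ i → g i ≡ a + k * h i) →
                     sum (map g is) ≡ length is * a + k * sum (map h is)
    sum-map-affine a k g h []       _  = sym (*-zeroʳ k)
    sum-map-affine a k g h (i ∷ is) g≡ =
      trans (cong₂ _+_ (g≡ i) (sum-map-affine a k g h is g≡)) (regroup a k (h i) (length is) _)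
      where
      regroup : ∀ a k x n s → (a + k * x) + (n * a + k * s) ≡ (a + n * a) + k * (x + s)
      regroup = solve-∀

    ∣-sum : ∀ {d} (g : I → ℕ) is → (∀ i → d ∣ g i) → d ∣ sum (map g is)
    ∣-sum g []       _   = _ ∣0
    ∣-sum g (i ∷ is) d∣g = ∣m∣n⇒∣m+n (d∣g i) (∣-sum g is d∣g)

  module _ {I : Set} (g : I → Bool) where

    ∧-distribˡ-any : ∀ b is → (b ∧ any g is) ≡ any (λ i → b ∧ g i) is
    ∧-distribˡ-any b []       = ∧-zeroʳ b
    ∧-distribˡ-any b (i ∷ is) =
      trans (∧-distribˡ-∨ b (g i) _) (cong ((b ∧ g i) ∨_) (∧-distribˡ-any b is))

    ∧-distribʳ-any : ∀ c is → (any g is ∧ c) ≡ any (λ i → g i ∧ c) is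
    ∧-distribʳ-any c []       = refl
    ∧-distribʳ-any c (i ∷ is) =
      trans (∧-distribʳ-∨ c (g i) _) (cong ((g i ∧ c) ∨_) (∧-distribʳ-any c is))

  module _ {I A : Set} (f : I → A → Bool) where

    count-any : ∀ is → AllPairs _≢_ is → (∀ {i j} → i ≢ j → ∀ x → (f i x ∧ f j x) ≡ false) →
                ∀ xs → count (λ x → any (λ i → f i x) is) xs ≡ sum (map (λ i → count (f i) xs) is)
    count-any []       _                   _        xs = count-none _ xs (universal (λ _ → refl) xs)
    count-any (i ∷ is) (i∉is ∷ distinct) disjoint xs =
      trans (count-∨ (f i) _ xs (λ x → exclusive x is i∉is))
            (cong (count (f i) xs +_) (count-any is distinct disjoint xs))
      where
      exclusive : ∀ x js → All (i ≢_) js → (f i x ∧ any (λ j → f j x) js) ≡ false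
      exclusive x []       []           = ∧-zeroʳ (f i x)
      exclusive x (j ∷ js) (i≢j ∷ i∉js) = begin
        f i x ∧ (f j x ∨ any (λ j → f j x) js)
          ≡⟨ ∧-distribˡ-∨ (f i x) (f j x) _ ⟩
        (f i x ∧ f j x) ∨ (f i x ∧ any (λ j → f j x) js)
          ≡⟨ cong₂ _∨_ (disjoint i≢j x) (exclusive x js i∉js) ⟩
        false
          ∎
        where open ≡-Reasoning

  module UniqueLists (S : Setoid 0ℓ 0ℓ) where

    open Setoid S renaming (Carrier to A; refl to ≈-refl; sym to ≈-sym; trans to ≈-trans)
    open import Data.List.Membership.Setoid S public using (_∈_)
    open import Data.List.Relation.Unary.Unique.Setoid S public using (Unique)
    open import Data.List.Relation.Unary.Unique.Setoid renaming (Unique to UniqueIn) using ()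
    import Data.List.Membership.Setoid.Properties as ∈
    import Data.List.Relation.Unary.Unique.Setoid.Properties as Unique

    private
      ∈⇒≉ : ∀ {x z xs} → All (λ y → ¬ x ≈ y) xs → z ∈ xs → ¬ z ≈ x
      ∈⇒≉ (x≉y ∷ _)  (here z≈y)  z≈x = x≉y (≈-trans (≈-sym z≈x) z≈y)
      ∈⇒≉ (_ ∷ x∉xs) (there z∈xs)    = ∈⇒≉ x∉xs z∈xs

      remove : ∀ {x} ys → x ∈ ys → List A
      remove (_ ∷ ys) (here _)  = ys
      remove (y ∷ ys) (there p) = y ∷ remove ys p

      count-remove : ∀ {P} → Congruent _≈_ _≡_ P → ∀ {x} ys (p : x ∈ ys) →
                     count P ys ≡ count P (x ∷ remove ys p)
      count-remove P-cong (y ∷ ys) (here x≈y) rewrite P-cong x≈y = refl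
      count-remove {P} P-cong {x} (y ∷ ys) (there p) rewrite count-remove P-cong ys p with P x | P y
      ... | true  | true  = refl
      ... | true  | false = refl
      ... | false | true  = refl
      ... | false | false = refl

      ∈-remove⁻ : ∀ {x z} ys (p : x ∈ ys) → z ∈ remove ys p → z ∈ ys
      ∈-remove⁻ (y ∷ ys) (here _)  z∈         = there z∈
      ∈-remove⁻ (y ∷ ys) (there p) (here z≈y) = here z≈y
      ∈-remove⁻ (y ∷ ys) (there p) (there z∈) = there (∈-remove⁻ ys p z∈)

      ∈-remove⁺ : ∀ {x z} ys (p : x ∈ ys) → z ∈ ys → ¬ z ≈ x → z ∈ remove ys p
      ∈-remove⁺ (y ∷ ys) (here x≈y) (here z≈y) z≉x = ⊥-elim (z≉x (≈-trans z≈y (≈-sym x≈y)))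
      ∈-remove⁺ (y ∷ ys) (here _)   (there z∈) _   = z∈
      ∈-remove⁺ (y ∷ ys) (there p)  (here z≈y) _   = here z≈y
      ∈-remove⁺ (y ∷ ys) (there p)  (there z∈) z≉x = there (∈-remove⁺ ys p z∈ z≉x)

      remove-unique : ∀ {x} ys (p : x ∈ ys) → Unique ys → Unique (remove ys p)
      remove-unique (y ∷ ys) (here _)  (_ ∷ ys!)     = ys!
      remove-unique (y ∷ ys) (there p) (y∉ys ∷ ys!) = All-remove ys p y∉ys ∷ remove-unique ys p ys!
        where
        All-remove : ∀ {Q : A → Set} {x} ys (p : x ∈ ys) → All Q ys → All Q (remove ys p)
        All-remove (y ∷ ys) (here _)  (_ ∷ qs)  = qs
        All-remove (y ∷ ys) (there p) (q ∷ qs) = q ∷ All-remove ys p qs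

      ∈-remove⇒≉ : ∀ {x z} ys (p : x ∈ ys) → Unique ys → z ∈ remove ys p → ¬ z ≈ x
      ∈-remove⇒≉ (y ∷ ys) (here x≈y) (y∉ys ∷ _) z∈ z≈x = ∈⇒≉ y∉ys z∈ (≈-trans z≈x x≈y)
      ∈-remove⇒≉ (y ∷ ys) (there p) (y∉ys ∷ _) (here z≈y) z≈x =
        ∈⇒≉ y∉ys p (≈-trans (≈-sym z≈x) z≈y)
      ∈-remove⇒≉ (y ∷ ys) (there p) (_ ∷ ys!) (there z∈) = ∈-remove⇒≉ ys p ys! z∈

    count-sameMembers : ∀ {P} → Congruent _≈_ _≡_ P → ∀ {xs ys} → Unique xs → Unique ys →
                        (∀ {z} → z ∈ xs → z ∈ ys) → (∀ {z} → z ∈ ys → z ∈ xs) →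
                        count P xs ≡ count P ys
    count-sameMembers P-cong {[]}     {[]}     _ _ _ _ = refl
    count-sameMembers P-cong {[]}     {y ∷ ys} _ _ _ from with from (here ≈-refl)
    ... | ()
    count-sameMembers {P} P-cong {x ∷ xs} {ys} (x∉xs ∷ xs!) ys! to from =
      trans (cong (λ n → if P x then suc n else n)
                  (count-sameMembers P-cong xs! (remove-unique ys x∈ys ys!) to′ from′))
            (sym (count-remove P-cong ys x∈ys))
      where
      x∈ys : x ∈ ys
      x∈ys = to (here ≈-refl)
      to′ : ∀ {z} → z ∈ xs → z ∈ remove ys x∈ys
      to′ z∈xs = ∈-remove⁺ ys x∈ys (to (there z∈xs)) (∈⇒≉ x∉xs z∈xs)
      from′ : ∀ {z} → z ∈ remove ys x∈ys → z ∈ xs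
      from′ z∈ with from (∈-remove⁻ ys x∈ys z∈)
      ... | here z≈x  = ⊥-elim (∈-remove⇒≉ ys x∈ys ys! z∈ z≈x)
      ... | there z∈xs = z∈xs

    count-∈ : ∀ {P} → Congruent _≈_ _≡_ P → ∀ {x xs} → x ∈ xs → P x ≡ true → 1 ≤ count P xs
    count-∈ {P} P-cong {x} {y ∷ ys} (here x≈y) Px rewrite sym (P-cong x≈y) | Px = s≤s z≤n
    count-∈ {P} P-cong {x} {y ∷ ys} (there x∈) Px with P y
    ... | true  = s≤s z≤n
    ... | false = count-∈ P-cong x∈ Px

    All-∈ : ∀ {P : A → Bool} {b} → Congruent _≈_ _≡_ P →
            ∀ {xs x} → All (λ y → P y ≡ b) xs → x ∈ xs → P x ≡ b
    All-∈ P-cong (Py ∷ _)  (here x≈y)  = trans (P-cong x≈y) Py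
    All-∈ P-cong (_ ∷ all) (there x∈) = All-∈ P-cong all x∈

    module _ {Q : A → Bool} (Q-cong : Congruent _≈_ _≡_ Q) where

      private
        T∘Q-resp : ∀ {x y} → x ≈ y → T (Q x) → T (Q y)
        T∘Q-resp x≈y = subst T (Q-cong x≈y)

      ∈-filterᵇ⁺ : ∀ {x xs} → x ∈ xs → Q x ≡ true → x ∈ filterᵇ Q xs
      ∈-filterᵇ⁺ x∈ Qx = ∈.∈-filter⁺ S (T? ∘ Q) T∘Q-resp x∈ (Equivalence.from T-≡ Qx)

      ∈-filterᵇ⁻ : ∀ {x} xs → x ∈ filterᵇ Q xs → x ∈ xs × Q x ≡ true
      ∈-filterᵇ⁻ xs x∈ =
        map₂ (Equivalence.to T-≡) (∈.∈-filter⁻ S (T? ∘ Q) T∘Q-resp {xs = xs} x∈)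

    filterᵇ-unique : ∀ (Q : A → Bool) {xs} → Unique xs → Unique (filterᵇ Q xs)
    filterᵇ-unique Q = Unique.filter⁺ S (T? ∘ Q)

    record Enumerates (Q : A → Bool) (xs : List A) : Set where
      field
        unique   : Unique xs
        sound    : ∀ {z} → z ∈ xs → Q z ≡ true
        complete : ∀ {z} → Q z ≡ true → z ∈ xs

    module _ {M : List A} (M-unique : Unique M) (M-complete : ∀ z → z ∈ M) where

      count-enumeration : ∀ {Q P xs} → Congruent _≈_ _≡_ Q → Congruent _≈_ _≡_ P → Enumerates Q xs →
                          count P xs ≡ count (λ x → Q x ∧ P x) M
      count-enumeration {Q} {P} {xs} Q-cong P-cong enum =
        trans (count-sameMembers P-cong unique (filterᵇ-unique Q M-unique)
                 (λ {z} z∈ → ∈-filterᵇ⁺ Q-cong (M-complete z) (sound z∈))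
                 (λ z∈ → complete (proj₂ (∈-filterᵇ⁻ Q-cong M z∈))))
              (count-filterᵇ Q P M)
        where open Enumerates enum

      length-enumeration : ∀ {Q xs} → Congruent _≈_ _≡_ Q → Enumerates Q xs → length xs ≡ count Q M
      length-enumeration {Q} {xs} Q-cong enum = begin
        length xs                        ≡⟨ count-true xs ⟨
        count (λ _ → true) xs            ≡⟨ count-enumeration Q-cong (λ _ → refl) enum ⟩
        count (λ x → Q x ∧ true) M       ≡⟨ count-cong (λ x → ∧-identityʳ (Q x)) M ⟩
        count Q M                        ∎
        where open ≡-Reasoning

    module _ {B : Setoid 0ℓ 0ℓ} (f : Setoid.Carrier B → List A) where

      open Setoid B using () renaming (_≈_ to _≈ᴮ_; refl to ≈ᴮ-refl)

      Unique-concatMap : ∀ {bs} → UniqueIn B bs → (∀ {b} → Any (b ≈ᴮ_) bs → Unique (f b)) →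
                         (∀ {a b z} → Any (a ≈ᴮ_) bs → Any (b ≈ᴮ_) bs →
                                      z ∈ f a → z ∈ f b → a ≈ᴮ b) →
                         Unique (concatMap f bs)
      Unique-concatMap {[]}     _            _  _         = []
      Unique-concatMap {b ∷ bs} (b∉bs ∷ bs!) f! separated =
        Unique.++⁺ S (f! (here ≈ᴮ-refl))
          (Unique-concatMap bs! (f! ∘ there) (λ a∈ c∈ → separated (there a∈) (there c∈)))
          (λ (z∈fb , z∈rest) →
             disjoint b∉bs (separated (here ≈ᴮ-refl) ∘ there) z∈fb (∈.∈-concatMap⁻ B S z∈rest))
        where
        disjoint : ∀ {z cs} → All (λ c → ¬ b ≈ᴮ c) cs →
                   (∀ {c} → Any (c ≈ᴮ_) cs → z ∈ f b → z ∈ f c → b ≈ᴮ c) →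
                   z ∈ f b → Any ((z ∈_) ∘ f) cs → ⊥
        disjoint (b≉c ∷ _)   sep z∈fb (here z∈fc) = b≉c (sep (here ≈ᴮ-refl) z∈fb z∈fc)
        disjoint (_ ∷ b∉cs) sep z∈fb (there z∈)  = disjoint b∉cs (sep ∘ there) z∈fb z∈

module Divisibility where

  open import Data.Nat using (_+_; _*_; _^_)
  open import Data.Nat.Properties using (+-comm; m≤m+n; m+n∸m≡n)
  open import Data.Nat.Divisibility using (_∣_; ∣-trans; ∣m+n∣m⇒∣n; ∣1⇒≡1)
  open import Data.Nat.Coprimality using (Coprime; coprime-divisor; 1-coprimeTo)
  open import Data.Integer using (+_; _-_; ∣_∣)
  open import Data.Integer.Properties using ([+m]-[+n]≡m⊖n; ∣⊖∣-≤)
  import Data.Integer.Divisibility as ℤ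

  coprime-suc : ∀ n → Coprime (suc n) n
  coprime-suc n {d} (d∣1+n , d∣n) =
    ∣1⇒≡1 (∣m+n∣m⇒∣n (≡.subst (d ∣_) (+-comm 1 n) d∣1+n) d∣n)

  coprime-*ˡ : ∀ {a b n} → Coprime a n → Coprime b n → Coprime (a * b) n
  coprime-*ˡ {a} {b} {n} a⊥n b⊥n {d} (d∣ab , d∣n) = b⊥n (coprime-divisor d⊥a d∣ab , d∣n)
    where
    d⊥a : Coprime d a
    d⊥a (e∣d , e∣a) = a⊥n (e∣a , ∣-trans e∣d d∣n)

  coprime-^ˡ : ∀ {a n} r → Coprime a n → Coprime (a ^ r) n
  coprime-^ˡ {n = n} zero    a⊥n = 1-coprimeTo n
  coprime-^ˡ         (suc r) a⊥n = coprime-*ˡ a⊥n (coprime-^ˡ r a⊥n)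

  ∣[+m]-[+[m+n]] : ∀ {d} m {n} → d ∣ n → + d ℤ.∣ (+ m - + (m + n))
  ∣[+m]-[+[m+n]] {d} m {n} d∣n = ≡.subst (d ∣_) (≡.sym ∣m-[m+n]∣≡n) d∣n
    where
    ∣m-[m+n]∣≡n : ∣ + m - + (m + n) ∣ ≡ n
    ∣m-[m+n]∣≡n = ≡.trans (≡.cong ∣_∣ ([+m]-[+n]≡m⊖n m (m + n)))
                          (≡.trans (∣⊖∣-≤ (m≤m+n m n)) (m+n∸m≡n m n))

module VectorAlgebra (F : FiniteField) where

  open FiniteField F
  open Geometry F
  open import Data.Vec.Relation.Binary.Pointwise.Inductive as PW using ([]; _∷_)
  import Data.Vec.Relation.Unary.All as VAll
  import Relation.Binary.Reasoning.Setoid as ≈-Reasoning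
  open import Algebra.Properties.Ring ring using (-1*x≈-x)
  open import Algebra.Properties.Group +-group using (x∙y⁻¹≈ε⇒x≈y)

  ≋-setoid : ℕ → Setoid 0ℓ 0ℓ
  ≋-setoid = PW.setoid setoid

  module _ {v : ℕ} where
    open Setoid (≋-setoid v) public using () renaming (refl to ≋-refl; sym to ≋-sym; trans to ≋-trans)

  infixl 6 _⊖_
  _⊖_ : ∀ {v} → V v → V v → V v
  x ⊖ y = x ⊕ ((- 1#) ⊙ y)

  Independent : ∀ {v k} → Vec (V v) k → Set
  Independent b = ∀ c → lincomb c b ≋ 0v → VAll.All (_≈ 0#) c

  ≉0∧*≈0⇒≈0 : ∀ {a x} → ¬ a ≈ 0# → a * x ≈ 0# → x ≈ 0#
  ≉0∧*≈0⇒≈0 {a} {x} a≉0 ax≈0 with inverse a a≉0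
  ... | b , ab≈1 = begin
    x           ≈⟨ *-identityˡ x ⟨
    1# * x      ≈⟨ *-congʳ (trans (sym ab≈1) (*-comm a b)) ⟩
    (b * a) * x ≈⟨ *-assoc b a x ⟩
    b * (a * x) ≈⟨ *-congˡ ax≈0 ⟩
    b * 0#      ≈⟨ zeroʳ b ⟩
    0#          ∎
    where open ≈-Reasoning setoid

  ⊕-cong : ∀ {v} {x x′ y y′ : V v} → x ≋ x′ → y ≋ y′ → (x ⊕ y) ≋ (x′ ⊕ y′)
  ⊕-cong = PW.zipWith-cong +-cong

  ⊙-cong : ∀ {v} {a a′} {x x′ : V v} → a ≈ a′ → x ≋ x′ → (a ⊙ x) ≋ (a′ ⊙ x′)
  ⊙-cong a≈a′ = PW.map⁺ (*-cong a≈a′)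

  ⊕-comm : ∀ {v} (x y : V v) → (x ⊕ y) ≋ (y ⊕ x)
  ⊕-comm = PW.zipWith-comm +-comm

  ⊕-assoc : ∀ {v} (x y z : V v) → ((x ⊕ y) ⊕ z) ≋ (x ⊕ (y ⊕ z))
  ⊕-assoc = PW.zipWith-assoc +-assoc

  ⊕-identityˡ : ∀ {v} (x : V v) → (0v ⊕ x) ≋ x
  ⊕-identityˡ = PW.zipWith-identityˡ +-identityˡ

  ⊕-identityʳ : ∀ {v} (x : V v) → (x ⊕ 0v) ≋ x
  ⊕-identityʳ = PW.zipWith-identityʳ +-identityʳ

  ⊙-distribˡ : ∀ {v} a (x y : V v) → (a ⊙ (x ⊕ y)) ≋ ((a ⊙ x) ⊕ (a ⊙ y))
  ⊙-distribˡ a []      []      = []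
  ⊙-distribˡ a (b ∷ x) (c ∷ y) = distribˡ a b c ∷ ⊙-distribˡ a x y

  ⊙-distribʳ : ∀ {v} a b (x : V v) → ((a + b) ⊙ x) ≋ ((a ⊙ x) ⊕ (b ⊙ x))
  ⊙-distribʳ a b []      = []
  ⊙-distribʳ a b (c ∷ x) = distribʳ c a b ∷ ⊙-distribʳ a b x

  ⊙-assoc : ∀ {v} a b (x : V v) → ((a * b) ⊙ x) ≋ (a ⊙ (b ⊙ x))
  ⊙-assoc a b []      = []
  ⊙-assoc a b (c ∷ x) = *-assoc a b c ∷ ⊙-assoc a b x

  ⊙-identityˡ : ∀ {v} (x : V v) → (1# ⊙ x) ≋ x
  ⊙-identityˡ []      = []
  ⊙-identityˡ (c ∷ x) = *-identityˡ c ∷ ⊙-identityˡ x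

  ⊙-zeroˡ : ∀ {v} (x : V v) → (0# ⊙ x) ≋ 0v
  ⊙-zeroˡ []      = []
  ⊙-zeroˡ (c ∷ x) = zeroˡ c ∷ ⊙-zeroˡ x

  ⊙-zeroʳ : ∀ {v} a → (a ⊙ 0v {v}) ≋ 0v
  ⊙-zeroʳ {zero}  a = []
  ⊙-zeroʳ {suc v} a = zeroʳ a ∷ ⊙-zeroʳ a

  ⊖-self : ∀ {v} (x : V v) → (x ⊖ x) ≋ 0v
  ⊖-self []      = []
  ⊖-self (a ∷ x) = trans (+-congˡ (-1*x≈-x a)) (-‿inverseʳ a) ∷ ⊖-self x

  ⊖≋0⇒≋ : ∀ {v} {x y : V v} → (x ⊖ y) ≋ 0v → x ≋ y
  ⊖≋0⇒≋ {x = []}    {[]}    []       = []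
  ⊖≋0⇒≋ {x = a ∷ x} {b ∷ y} (e ∷ es) =
    x∙y⁻¹≈ε⇒x≈y a b (trans (+-congˡ (sym (-1*x≈-x b))) e) ∷ ⊖≋0⇒≋ es

  ⊕⊖ : ∀ {v} (x t : V v) → ((x ⊕ t) ⊖ t) ≋ x
  ⊕⊖ x t = ≋-trans (⊕-assoc x t _) (≋-trans (⊕-cong ≋-refl (⊖-self t)) (⊕-identityʳ x))

  ⊖⊕ : ∀ {v} (x t : V v) → ((x ⊖ t) ⊕ t) ≋ x
  ⊖⊕ x t = ≋-trans (⊕-assoc x _ t)
                   (≋-trans (⊕-cong ≋-refl (≋-trans (⊕-comm _ t) (⊖-self t))) (⊕-identityʳ x))

  ⊕⊖-comm : ∀ {v} (x t a : V v) → ((x ⊕ t) ⊖ a) ≋ ((x ⊖ a) ⊕ t)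
  ⊕⊖-comm x t a =
    ≋-trans (⊕-assoc x t _) (≋-trans (⊕-cong ≋-refl (⊕-comm t _)) (≋-sym (⊕-assoc x _ t)))

  ⊕-injectiveʳ : ∀ {v} (t : V v) {x y} → (x ⊕ t) ≋ (y ⊕ t) → x ≋ y
  ⊕-injectiveʳ t {x} {y} e = ≋-trans (≋-sym (⊕⊖ x t)) (≋-trans (⊕-cong e ≋-refl) (⊕⊖ y t))

  ⊙-cancel : ∀ {v} {a} {x : V v} → ¬ a ≈ 0# → (a ⊙ x) ≋ 0v → x ≋ 0v
  ⊙-cancel {x = []}    a≉0 []       = []
  ⊙-cancel {x = c ∷ x} a≉0 (e ∷ es) = ≉0∧*≈0⇒≈0 a≉0 e ∷ ⊙-cancel a≉0 es

  ⊙-⊖ : ∀ {v} a (x y : V v) → (a ⊙ (x ⊖ y)) ≋ ((a ⊙ x) ⊖ (a ⊙ y))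
  ⊙-⊖ a x y = ≋-trans (⊙-distribˡ a x _) (⊕-cong ≋-refl (≋-trans (≋-sym (⊙-assoc a (- 1#) y))
    (≋-trans (⊙-cong (*-comm a (- 1#)) ≋-refl) (⊙-assoc (- 1#) a y))))

  ⊙-injective : ∀ {v} {a} {x y : V v} → ¬ a ≈ 0# → (a ⊙ x) ≋ (a ⊙ y) → x ≋ y
  ⊙-injective {a = a} {x} {y} a≉0 e =
    ⊖≋0⇒≋ (⊙-cancel a≉0 (≋-trans (⊙-⊖ a x y) (≋-trans (⊕-cong e ≋-refl) (⊖-self _))))

  lincomb-cong : ∀ {v k} {c c′ : V k} (b : Vec (V v) k) → c ≋ c′ → lincomb c b ≋ lincomb c′ b
  lincomb-cong []      []       = ≋-refl
  lincomb-cong (x ∷ b) (e ∷ es) = ⊕-cong (⊙-cong e ≋-refl) (lincomb-cong b es)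

  lincomb-0 : ∀ {v k} (b : Vec (V v) k) → lincomb 0v b ≋ 0v
  lincomb-0 []      = ≋-refl
  lincomb-0 (x ∷ b) = ≋-trans (⊕-cong (⊙-zeroˡ x) (lincomb-0 b)) (⊕-identityˡ 0v)

  lincomb-⊕ : ∀ {v k} (c c′ : V k) (b : Vec (V v) k) →
              lincomb (c ⊕ c′) b ≋ (lincomb c b ⊕ lincomb c′ b)
  lincomb-⊕ []      []        []      = ≋-sym (⊕-identityˡ 0v)
  lincomb-⊕ (a ∷ c) (a′ ∷ c′) (x ∷ b) =
    ≋-trans (⊕-cong (⊙-distribʳ a a′ x) (lincomb-⊕ c c′ b)) (interchange (a ⊙ x) (a′ ⊙ x) _ _)
    where
    interchange : ∀ {v} (p q r s : V v) → ((p ⊕ q) ⊕ (r ⊕ s)) ≋ ((p ⊕ r) ⊕ (q ⊕ s))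
    interchange p q r s =
      ≋-trans (⊕-assoc p q _) (≋-trans (⊕-cong ≋-refl q+[r+s]≋r+[q+s]) (≋-sym (⊕-assoc p r _)))
      where
      q+[r+s]≋r+[q+s] : (q ⊕ (r ⊕ s)) ≋ (r ⊕ (q ⊕ s))
      q+[r+s]≋r+[q+s] =
        ≋-trans (≋-sym (⊕-assoc q r s)) (≋-trans (⊕-cong (⊕-comm q r) ≋-refl) (⊕-assoc r q s))

  lincomb-⊙ : ∀ {v k} a (c : V k) (b : Vec (V v) k) → lincomb (a ⊙ c) b ≋ (a ⊙ lincomb c b)
  lincomb-⊙ a []      []      = ≋-sym (⊙-zeroʳ a)
  lincomb-⊙ a (d ∷ c) (x ∷ b) =
    ≋-trans (⊕-cong (⊙-assoc a d x) (lincomb-⊙ a c b)) (≋-sym (⊙-distribˡ a (d ⊙ x) (lincomb c b)))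

  lincomb-⊖ : ∀ {v k} (c c′ : V k) (b : Vec (V v) k) →
              lincomb (c ⊖ c′) b ≋ (lincomb c b ⊖ lincomb c′ b)
  lincomb-⊖ c c′ b = ≋-trans (lincomb-⊕ c ((- 1#) ⊙ c′) b) (⊕-cong ≋-refl (lincomb-⊙ (- 1#) c′ b))

  lincomb-injective : ∀ {v k} {b : Vec (V v) k} → Independent b →
                      ∀ {c c′} → lincomb c b ≋ lincomb c′ b → c ≋ c′
  lincomb-injective {b = b} ind {c} {c′} e =
    ⊖≋0⇒≋ (All⇒≋0 (ind (c ⊖ c′) (≋-trans (lincomb-⊖ c c′ b)
                                          (≋-trans (⊕-cong e ≋-refl) (⊖-self _)))))
    where
    All⇒≋0 : ∀ {r} {c : V r} → VAll.All (_≈ 0#) c → c ≋ 0v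
    All⇒≋0 VAll.[]       = []
    All⇒≋0 (e VAll.∷ es) = e ∷ All⇒≋0 es

module VectorCounting (F : FiniteField) where

  open FiniteField F hiding (_+_) renaming (_*_ to _*ᶠ_)
  open Geometry F
  open VectorAlgebra F
  open Counting
  import Relation.Binary.Reasoning.Setoid as ≈-Reasoning
  open import Data.Nat using (_+_; _*_; _^_; _≤_)
  open import Data.Nat.Properties using (≤-refl; ≤-trans; ≤-pred; n≤0⇒n≡0; +-monoˡ-≤)
  open import Data.Nat.Divisibility using (_∣_; _∣0; ∣-refl; ∣m∣n⇒∣m+n)
  open import Data.Bool.Properties using (∧-zeroʳ; ∧-identityʳ; ∧-conicalˡ; ∧-conicalʳ)
  open import Data.List.Relation.Unary.All using (universal)
  open import Data.List using (map; concatMap; length; filterᵇ)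
  open import Data.List.Properties using (length-map)
  open import Function.Bundles using (mk⇔)
  open import Data.Vec.Relation.Binary.Pointwise.Inductive as PW using ([]; _∷_)
  open import Relation.Nullary using (yes; no; does)
  open import Relation.Nullary.Decidable using (dec-true; dec-false; does-⇔)
  import Data.List.Relation.Unary.All as All
  import Data.List.Relation.Unary.Any as Any
  import Data.Vec.Relation.Unary.All as VAll
  import Data.List.Membership.Setoid.Properties as ∈
  open import Data.List.Membership.Setoid setoid using () renaming (find to findₛ)
  import Data.List.Relation.Unary.Unique.Setoid.Properties as Unique

  module _ {v : ℕ} where
    open UniqueLists (≋-setoid v) public

  #vectors : ∀ v → (V v → Bool) → ℕ
  #vectors v P = count P (allVecs v)

  allVecs-complete : ∀ v (x : V v) → x ∈ allVecs v
  allVecs-complete zero    []      = here []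
  allVecs-complete (suc v) (a ∷ x) =
    ∈.∈-concatMap⁺ setoid (≋-setoid (suc v)) (Any.map a∷x∈ (complete a))
    where
    a∷x∈ : ∀ {b} → a ≈ b → (a ∷ x) ∈ map (b ∷_) (allVecs v)
    a∷x∈ a≈b = ∈.∈-resp-≈ (≋-setoid (suc v)) (≋-sym (a≈b ∷ ≋-refl))
                 (∈.∈-map⁺ (≋-setoid v) (≋-setoid (suc v)) (refl ∷_) (allVecs-complete v x))

  allVecs-unique : ∀ v → Unique (allVecs v)
  allVecs-unique zero    = [] ∷ []
  allVecs-unique (suc v) = Unique-concatMap {B = setoid} (λ a → map (a ∷_) (allVecs v)) distinct
    (λ _ → Unique.map⁺ (≋-setoid v) (≋-setoid (suc v)) PW.tail (allVecs-unique v)) (λ _ _ → head≈)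
    where
    head≈ : ∀ {a b z} → z ∈ map (a ∷_) (allVecs v) → z ∈ map (b ∷_) (allVecs v) → a ≈ b
    head≈ z∈a z∈b with ∈.∈-map⁻ (≋-setoid v) (≋-setoid (suc v)) z∈a
                     | ∈.∈-map⁻ (≋-setoid v) (≋-setoid (suc v)) z∈b
    ... | _ , _ , z≈a ∷ _ | _ , _ , z≈b ∷ _ = trans (sym z≈a) z≈b

  length-allVecs : ∀ v → length (allVecs v) ≡ order ^ v
  length-allVecs zero    = ≡.refl
  length-allVecs (suc v) = begin
    length (allVecs (suc v))             ≡⟨ count-true (allVecs (suc v)) ⟨
    count (λ _ → true) (allVecs (suc v)) ≡⟨ count-concatMap (λ _ → true) _ (universal block elements) ⟩
    order * order ^ v                    ∎
    where
    open ≡-Reasoning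
    block : ∀ a → count (λ _ → true) (map (a ∷_) (allVecs v)) ≡ order ^ v
    block a = ≡.trans (count-map _ (a ∷_) (allVecs v)) (≡.trans (count-true (allVecs v)) (length-allVecs v))

  #vectors-enumeration : ∀ {v Q xs} → Congruent _≋_ _≡_ Q → Enumerates Q xs → #vectors v Q ≡ length xs
  #vectors-enumeration {v} Q-cong enum =
    ≡.sym (length-enumeration (allVecs-unique v) (allVecs-complete v) Q-cong enum)

  infix 5 _∈ᵇ_
  _∈ᵇ_ : ∀ {v} → V v → List (V v) → Bool
  x ∈ᵇ xs = does (Any.any? (PW.decidable _≟_ x) xs)

  ∈ᵇ⇒∈ : ∀ {v} {x : V v} {xs} → x ∈ᵇ xs ≡ true → x ∈ xs
  ∈ᵇ⇒∈ {x = x} {xs} e with Any.any? (PW.decidable _≟_ x) xs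
  ... | yes x∈xs = x∈xs

  ∈⇒∈ᵇ : ∀ {v} {x : V v} {xs} → x ∈ xs → x ∈ᵇ xs ≡ true
  ∈⇒∈ᵇ {x = x} {xs} = dec-true (Any.any? (PW.decidable _≟_ x) xs)

  ∈ᵇ-cong : ∀ {v} (xs : List (V v)) → Congruent _≋_ _≡_ (_∈ᵇ xs)
  ∈ᵇ-cong {v} xs {x} {y} x≋y =
    does-⇔ (mk⇔ (∈.∈-resp-≈ (≋-setoid v) x≋y) (∈.∈-resp-≈ (≋-setoid v) (≋-sym x≋y)))
           (Any.any? (PW.decidable _≟_ x) xs) (Any.any? (PW.decidable _≟_ y) xs)

  combinations : ∀ {v k} → Vec (V v) k → List (V v)
  combinations {k = k} b = map (λ c → lincomb c b) (allVecs k)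

  module _ {v k} (b : Vec (V v) k) where

    ∈-combinations⁺ : ∀ {z} c → z ≋ lincomb c b → z ∈ combinations b
    ∈-combinations⁺ c z≋ = ∈.∈-resp-≈ (≋-setoid v) (≋-sym z≋)
      (∈.∈-map⁺ (≋-setoid k) (≋-setoid v) (lincomb-cong b) (allVecs-complete k c))

    ∈-combinations⁻ : ∀ {z} → z ∈ combinations b → ∃ λ c → z ≋ lincomb c b
    ∈-combinations⁻ z∈ with ∈.∈-map⁻ (≋-setoid k) (≋-setoid v) z∈
    ... | c , _ , z≋ = c , z≋

    combinations-unique : Independent b → Unique (combinations b)
    combinations-unique ind = Unique.map⁺ (≋-setoid k) (≋-setoid v) (lincomb-injective ind) (allVecs-unique k)

    span : Subspace v
    span = record
      { mem      = _∈ᵇ combinations b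
      ; resp     = ∈ᵇ-cong (combinations b)
      ; zero∈    = ∈⇒∈ᵇ (∈-combinations⁺ 0v (≋-sym (lincomb-0 b)))
      ; +-closed = λ x∈ y∈ →
          +-closed′ (∈-combinations⁻ (∈ᵇ⇒∈ x∈)) (∈-combinations⁻ (∈ᵇ⇒∈ y∈))
      ; ·-closed = λ a x∈ → ·-closed′ a (∈-combinations⁻ (∈ᵇ⇒∈ x∈))
      }
      where
      +-closed′ : ∀ {x y} → ∃ (λ c → x ≋ lincomb c b) → ∃ (λ c → y ≋ lincomb c b) →
                  (x ⊕ y) ∈ᵇ combinations b ≡ true
      +-closed′ (c , x≋) (c′ , y≋) =
        ∈⇒∈ᵇ (∈-combinations⁺ (c ⊕ c′) (≋-trans (⊕-cong x≋ y≋) (≋-sym (lincomb-⊕ c c′ b))))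
      ·-closed′ : ∀ a {x} → ∃ (λ c → x ≋ lincomb c b) → (a ⊙ x) ∈ᵇ combinations b ≡ true
      ·-closed′ a (c , x≋) =
        ∈⇒∈ᵇ (∈-combinations⁺ (a ⊙ c) (≋-trans (⊙-cong refl x≋) (≋-sym (lincomb-⊙ a c b))))

    span-HasDim : Independent b → HasDim span k
    span-HasDim ind = b , (λ c → ∈⇒∈ᵇ (∈-combinations⁺ c ≋-refl))
                        , (λ x x∈ → ∈-combinations⁻ (∈ᵇ⇒∈ x∈))
                        , ind

  #vectors-HasDim : ∀ {v k} (S : Subspace v) → HasDim S k → #vectors v (mem S) ≡ order ^ k
  #vectors-HasDim {v} {k} S (b , inS , spans , ind) = begin
    #vectors v (mem S)      ≡⟨ #vectors-enumeration (resp S) enum ⟩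
    length (combinations b) ≡⟨ length-map _ (allVecs k) ⟩
    length (allVecs k)      ≡⟨ length-allVecs k ⟩
    order ^ k               ∎
    where
    open ≡-Reasoning
    enum : Enumerates (mem S) (combinations b)
    enum = record
      { unique   = combinations-unique b ind
      ; sound    = λ z∈ → let c , z≋ = ∈-combinations⁻ b z∈ in ≡.trans (resp S z≋) (inS c)
      ; complete = λ z∈S → let c , z≋ = spans _ z∈S in ∈-combinations⁺ b c z≋
      }

  infix 4 _⊆_
  _⊆_ : ∀ {v} → Subspace v → Subspace v → Set
  S ⊆ T = ∀ {x} → mem S x ≡ true → mem T x ≡ true

  span-⊆ : ∀ {v k} (S : Subspace v) {b : Vec (V v) k} → (∀ c → mem S (lincomb c b) ≡ true) → span b ⊆ S
  span-⊆ S {b} b⊆S x∈ =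
    let c , x≋ = ∈-combinations⁻ b (∈ᵇ⇒∈ x∈) in ≡.trans (resp S x≋) (b⊆S c)

  ScaleInvariant : ∀ {v} → (V v → Bool) → Set
  ScaleInvariant P = ∀ {a x} → ¬ a ≈ 0# → P (a ⊙ x) ≡ P x

  mem-scaleInvariant : ∀ {v} (S : Subspace v) → ScaleInvariant (mem S)
  mem-scaleInvariant S {a} {x} a≉0 with mem S x in x∈? | mem S (a ⊙ x) in ax∈?
  ... | true  | true  = ≡.refl
  ... | false | false = ≡.refl
  ... | true  | false = ⊥-elim (false≢true (≡.trans (≡.sym ax∈?) (·-closed S a x∈?)))
  ... | false | true  with inverse a a≉0
  ...   | i , ai≈1 =
    ⊥-elim (false≢true (≡.trans (≡.sym x∈?) (≡.trans (resp S x≋) (·-closed S i ax∈?))))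
    where
    x≋ : x ≋ (i ⊙ (a ⊙ x))
    x≋ = ≋-sym (≋-trans (≋-sym (⊙-assoc i a x))
                        (≋-trans (⊙-cong (trans (*-comm i a) ai≈1) ≋-refl) (⊙-identityˡ x)))

  Independent-∷ : ∀ {v k} {S : Subspace v} (hS : HasDim S k) {y} → mem S y ≡ false →
                  Independent (y ∷ proj₁ hS)
  Independent-∷ {S = S} (b , inS , _ , ind) {y} y∉S (d ∷ c) dy+L≋0 with d ≟ 0#
  ... | yes d≈0 =
    d≈0 VAll.∷ ind c (≋-trans (≋-sym (⊕-identityˡ _)) (≋-trans (⊕-cong 0≋dy ≋-refl) dy+L≋0))
    where
    0≋dy : 0v ≋ (d ⊙ y)
    0≋dy = ≋-sym (≋-trans (⊙-cong d≈0 ≋-refl) (⊙-zeroˡ y))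
  ... | no d≉0 =
    ⊥-elim (false≢true (≡.trans (≡.sym y∉S) (≡.trans (≡.sym (mem-scaleInvariant S d≉0)) dy∈S)))
    where
    L = lincomb c b
    dy∈S : mem S (d ⊙ y) ≡ true
    dy∈S = ≡.trans (resp S (≋-sym (⊕⊖ (d ⊙ y) L)))
             (+-closed S (≡.trans (resp S dy+L≋0) (zero∈ S)) (·-closed S (- 1#) (inS c)))

  all-false⊎witness : ∀ {v} (P : V v → Bool) → Congruent _≋_ _≡_ P →
                      (∀ x → P x ≡ false) ⊎ ∃ λ x → P x ≡ true
  all-false⊎witness {v} P P-cong with none⊎witness P (allVecs v)
  ... | inj₁ none = inj₁ λ x → All-∈ P-cong none (allVecs-complete v x)
  ... | inj₂ some = inj₂ (Any.satisfied some)

  #vectors-translate : ∀ {v} {A : V v → Bool} → Congruent _≋_ _≡_ A →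
                       ∀ t → #vectors v (λ x → A (x ⊕ t)) ≡ #vectors v A
  #vectors-translate {v} {A} A-cong t = ≡.trans (≡.sym (count-map A (_⊕ t) (allVecs v)))
    (count-sameMembers A-cong translates-unique (allVecs-unique v)
                       (λ {z} _ → allVecs-complete v z) (λ {z} _ → z∈ z))
    where
    translates-unique : Unique (map (_⊕ t) (allVecs v))
    translates-unique = Unique.map⁺ (≋-setoid v) (≋-setoid v) (⊕-injectiveʳ t) (allVecs-unique v)
    z∈ : ∀ z → z ∈ map (_⊕ t) (allVecs v)
    z∈ z = ∈.∈-resp-≈ (≋-setoid v) (⊖⊕ z t)
      (∈.∈-map⁺ (≋-setoid v) (≋-setoid v) (λ e → ⊕-cong e ≋-refl) (allVecs-complete v (z ⊖ t)))

  module _ {v} (T : Subspace v) where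

    TranslationInvariant : (V v → Bool) → Set
    TranslationInvariant A = ∀ {x t} → A x ≡ true → mem T t ≡ true → A (x ⊕ t) ≡ true

    private
      coset : V v → V v → Bool
      coset a x = mem T (x ⊖ a)

      module Peel {A} (A-cong : Congruent _≋_ _≡_ A) (A-inv : TranslationInvariant A)
                  {a} (a∈A : A a ≡ true) where

        rest : V v → Bool
        rest x = A x ∧ not (coset a x)

        rest-cong : Congruent _≋_ _≡_ rest
        rest-cong x≋y = ≡.cong₂ _∧_ (A-cong x≋y) (≡.cong not (resp T (⊕-cong x≋y ≋-refl)))

        rest-inv : TranslationInvariant rest
        rest-inv {x} {t} x∈rest t∈T with A x in x∈A | coset a x in x∈a+T | coset a (x ⊕ t) in x+t∈a+T
        ... | true | false | false rewrite A-inv x∈A t∈T = ≡.refl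
        ... | true | false | true = ⊥-elim (false≢true (≡.trans (≡.sym x∈a+T)
              (≡.trans (resp T (≋-sym (≋-trans (⊕-cong (⊕⊖-comm x t a) ≋-refl) (⊕⊖ (x ⊖ a) t))))
                (+-closed T x+t∈a+T (·-closed T (- 1#) t∈T)))))

        #vectors-peel : #vectors v A ≡ #vectors v (mem T) + #vectors v rest
        #vectors-peel = begin
          #vectors v A
            ≡⟨ count-split A (coset a) (allVecs v) ⟩
          #vectors v (λ x → A x ∧ coset a x) + #vectors v rest
            ≡⟨ ≡.cong (_+ #vectors v rest) (count-cong coset⊆A (allVecs v)) ⟩
          #vectors v (coset a) + #vectors v rest
            ≡⟨ ≡.cong (_+ #vectors v rest) (#vectors-translate (resp T) ((- 1#) ⊙ a)) ⟩
          #vectors v (mem T) + #vectors v rest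
            ∎
          where
          open ≡-Reasoning
          coset⊆A : ∀ x → (A x ∧ coset a x) ≡ coset a x
          coset⊆A x with coset a x in x∈a+T
          ... | false = ∧-zeroʳ (A x)
          ... | true  = ≡.trans (∧-identityʳ (A x))
                          (≡.trans (A-cong (≋-sym (≋-trans (⊕-comm a _) (⊖⊕ x a)))) (A-inv a∈A x∈a+T))

    -- A is a disjoint union of cosets of T: peel off the coset a + T of some a ∈ A and recurse.
    #vectors-∣-invariant : ∀ {A} → Congruent _≋_ _≡_ A → TranslationInvariant A →
                           #vectors v (mem T) ∣ #vectors v A
    #vectors-∣-invariant A-cong A-inv = go _ A-cong A-inv ≤-refl
      where
      go : ∀ n {A} → Congruent _≋_ _≡_ A → TranslationInvariant A → #vectors v A ≤ n →
           #vectors v (mem T) ∣ #vectors v A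
      go zero    A-cong A-inv #A≤0 rewrite n≤0⇒n≡0 #A≤0 = _ ∣0
      go (suc n) {A} A-cong A-inv #A≤1+n with all-false⊎witness A A-cong
      ... | inj₁ none = ≡.subst (_ ∣_) (≡.sym (count-none A (allVecs v) (universal none (allVecs v)))) (_ ∣0)
      ... | inj₂ (a , a∈A) =
        ≡.subst (_ ∣_) (≡.sym #vectors-peel) (∣m∣n⇒∣m+n ∣-refl (go n rest-cong rest-inv #rest≤n))
        where
        open Peel A-cong A-inv a∈A
        #T≥1 : 1 ≤ #vectors v (mem T)
        #T≥1 = count-∈ (resp T) (allVecs-complete v 0v) (zero∈ T)
        #rest≤n : #vectors v rest ≤ n
        #rest≤n = ≤-pred (≤-trans (+-monoˡ-≤ _ #T≥1) (≡.subst (_≤ suc n) #vectors-peel #A≤1+n))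

  isZero : Carrier → Bool
  isZero a = does (a ≟ 0#)

  ≟-cong : ∀ c → Congruent _≈_ _≡_ (λ a → does (a ≟ c))
  ≟-cong c {a} {b} a≈b = does-⇔ (mk⇔ (trans (sym a≈b)) (trans a≈b)) (a ≟ c) (b ≟ c)

  isZero-cong : Congruent _≈_ _≡_ isZero
  isZero-cong = ≟-cong 0#

  units : List Carrier
  units = filterᵇ (not ∘ isZero) elements

  #units : ℕ
  #units = length units

  private
    module Scalars = UniqueLists setoid

    isNonzero-cong : Congruent _≈_ _≡_ (not ∘ isZero)
    isNonzero-cong a≈b = ≡.cong not (isZero-cong a≈b)

  units-unique : Scalars.Unique units
  units-unique = Scalars.filterᵇ-unique (not ∘ isZero) distinct

  ∈-units⁺ : ∀ {a} → ¬ a ≈ 0# → Any (a ≈_) units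
  ∈-units⁺ {a} a≉0 =
    Scalars.∈-filterᵇ⁺ isNonzero-cong (complete a) (≡.cong not (dec-false (a ≟ 0#) a≉0))

  ∈-units⁻ : ∀ {a} → Any (a ≈_) units → ¬ a ≈ 0#
  ∈-units⁻ {a} a∈ a≈0 = false≢true (≡.trans (≡.sym (≡.cong not (dec-true (a ≟ 0#) a≈0)))
                                            (proj₂ (Scalars.∈-filterᵇ⁻ isNonzero-cong elements a∈)))

  order≡1+#units : order ≡ suc #units
  order≡1+#units = begin
    length elements                                                    ≡⟨ count-true elements ⟨
    count (λ _ → true) elements                                        ≡⟨ count-split _ isZero elements ⟩
    count isZero elements + count (λ a → not (isZero a)) elements      ≡⟨ ≡.cong₂ _+_ #zero #nonzero ⟩
    1 + #units                                                         ∎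
    where
    open ≡-Reasoning
    #zero : count isZero elements ≡ 1
    #zero = ≡.sym (Scalars.length-enumeration distinct complete isZero-cong record
      { unique   = [] ∷ []
      ; sound    = λ { (here a≈0) → dec-true (_ ≟ 0#) a≈0 }
      ; complete = λ {a} a≈0? → here (isZero⇒≈0 a a≈0?)
      })
      where
      isZero⇒≈0 : ∀ a → isZero a ≡ true → a ≈ 0#
      isZero⇒≈0 a _ with a ≟ 0#
      ... | yes a≈0 = a≈0
    #nonzero : count (λ a → not (isZero a)) elements ≡ #units
    #nonzero = ≡.sym (≡.trans (≡.sym (count-true units))
      (≡.trans (count-filterᵇ (not ∘ isZero) (λ _ → true) elements)
               (count-cong (λ a → ∧-identityʳ (not (isZero a))) elements)))

  isPoint-cong : ∀ {v} → Congruent _≋_ _≡_ (isPoint {v})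
  isPoint-cong []                              = ≡.refl
  isPoint-cong {x = x ∷ xs} {y ∷ ys} (x≈y ∷ xs≋ys)
    rewrite ≟-cong 0# x≈y | ≟-cong 1# x≈y | isPoint-cong xs≋ys = ≡.refl

  isPoint⇒≉0v : ∀ {v} {p : V v} → isPoint p ≡ true → ¬ p ≋ 0v
  isPoint⇒≉0v {v} {p} p-point p≋0 =
    false≢true (≡.trans (≡.sym (isPoint-0v v)) (≡.trans (≡.sym (isPoint-cong p≋0)) p-point))
    where
    isPoint-0v : ∀ v → isPoint (0v {v}) ≡ false
    isPoint-0v zero = ≡.refl
    isPoint-0v (suc v) rewrite dec-true (0# ≟ 0#) refl = isPoint-0v v

  normalize : ∀ {v} (w : V v) → ¬ w ≋ 0v →
              ∃ λ a → ∃ λ p → ¬ a ≈ 0# × isPoint p ≡ true × w ≋ (a ⊙ p)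
  normalize []       w≉0 = ⊥-elim (w≉0 [])
  normalize (x ∷ xs) w≉0 with x ≟ 0#
  ... | yes x≈0 with normalize xs (λ xs≋0 → w≉0 (x≈0 ∷ xs≋0))
  ...   | a , p , a≉0 , p-point , xs≋ap =
    a , 0# ∷ p , a≉0 , p′-point , trans x≈0 (sym (zeroʳ a)) ∷ xs≋ap
    where
    p′-point : isPoint (0# ∷ p) ≡ true
    p′-point rewrite dec-true (0# ≟ 0#) refl = p-point
  normalize (x ∷ xs) w≉0 | no x≉0 with inverse x x≉0
  ... | i , xi≈1 = x , i ⊙ (x ∷ xs) , x≉0 , p-point ,
    ≋-sym (≋-trans (≋-sym (⊙-assoc x i (x ∷ xs))) (≋-trans (⊙-cong xi≈1 ≋-refl) (⊙-identityˡ _)))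
    where
    ix≈1 : i *ᶠ x ≈ 1#
    ix≈1 = trans (*-comm i x) xi≈1
    p-point : isPoint (i ⊙ (x ∷ xs)) ≡ true
    p-point rewrite dec-false ((i *ᶠ x) ≟ 0#) (λ ix≈0 → 1≉0 (trans (sym ix≈1) ix≈0)) =
      dec-true ((i *ᶠ x) ≟ 1#) ix≈1

  ⊙-point-injective : ∀ {v} {a b} {p p′ : V v} → isPoint p ≡ true → isPoint p′ ≡ true →
                      ¬ a ≈ 0# → ¬ b ≈ 0# → (a ⊙ p) ≋ (b ⊙ p′) → a ≈ b
  ⊙-point-injective {a = a} {b} {x ∷ xs} {y ∷ ys} p-point p′-point a≉0 b≉0 (e ∷ es)
    with x ≟ 0# | y ≟ 0#
  ... | yes _   | yes _   = ⊙-point-injective p-point p′-point a≉0 b≉0 es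
  ... | yes x≈0 | no y≉0  =
    ⊥-elim (y≉0 (≉0∧*≈0⇒≈0 b≉0 (trans (sym e) (trans (*-congˡ x≈0) (zeroʳ a)))))
  ... | no x≉0  | yes y≈0 =
    ⊥-elim (x≉0 (≉0∧*≈0⇒≈0 a≉0 (trans e (trans (*-congˡ y≈0) (zeroʳ b)))))
  ... | no _    | no _ with x ≟ 1# | y ≟ 1#
  ...   | yes x≈1 | yes y≈1 = begin
    a      ≈⟨ *-identityʳ a ⟨
    a *ᶠ 1# ≈⟨ *-congˡ x≈1 ⟨
    a *ᶠ x  ≈⟨ e ⟩
    b *ᶠ y  ≈⟨ *-congˡ y≈1 ⟩
    b *ᶠ 1# ≈⟨ *-identityʳ b ⟩
    b      ∎
    where open ≈-Reasoning setoid

  #points≡count : ∀ v P → #points v P ≡ count (λ x → isPoint x ∧ P x) (allVecs v)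
  #points≡count v P = length-filter-≟true _ (allVecs v)


  points : ∀ v → List (V v)
  points v = filterᵇ isPoint (allVecs v)

  count-points : ∀ v P → count P (points v) ≡ #points v P
  count-points v P = ≡.trans (count-filterᵇ isPoint P (allVecs v)) (≡.sym (#points≡count v P))

  nonzero : ∀ {v} → V v → Bool
  nonzero {v} x = not (does (PW.decidable _≟_ x (0v {v})))

  nonzero-cong : ∀ {v} → Congruent _≋_ _≡_ (nonzero {v})
  nonzero-cong {v} {x} {y} x≋y = ≡.cong not (does-⇔ (mk⇔ (≋-trans (≋-sym x≋y)) (≋-trans x≋y))
    (PW.decidable _≟_ x (0v {v})) (PW.decidable _≟_ y (0v {v})))

  nonzero⇒≉0v : ∀ {v} {x : V v} → nonzero x ≡ true → ¬ x ≋ 0v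
  nonzero⇒≉0v {v} {x} x≉0 x≋0 =
    false≢true (≡.trans (≡.sym (≡.cong not (dec-true (PW.decidable _≟_ x (0v {v})) x≋0))) x≉0)

  ≉0v⇒nonzero : ∀ {v} {x : V v} → ¬ x ≋ 0v → nonzero x ≡ true
  ≉0v⇒nonzero {v} {x} x≉0 = ≡.cong not (dec-false (PW.decidable _≟_ x (0v {v})) x≉0)

  -- Every nonzero vector is a · p for exactly one unit a and one point p.
  nonzeroVecs : ∀ v → List (V v)
  nonzeroVecs v = concatMap (λ a → map (a ⊙_) (points v)) units

  nonzeroVecs-enumerates : ∀ v → Enumerates nonzero (nonzeroVecs v)
  nonzeroVecs-enumerates v = record
    { unique   = Unique-concatMap {B = setoid} block units-unique
        (λ a∈ → Unique.map⁺ (≋-setoid v) (≋-setoid v) (⊙-injective (∈-units⁻ a∈))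
                              (filterᵇ-unique isPoint (allVecs-unique v)))
        (λ a∈ b∈ z∈a z∈b →
           separate (∈-units⁻ a∈) (∈-units⁻ b∈) (∈-block⁻ z∈a) (∈-block⁻ z∈b))
    ; sound    = sound
    ; complete = complete′
    }
    where
    block : Carrier → List (V v)
    block a = map (a ⊙_) (points v)
    ∈-block⁻ : ∀ {a z} → z ∈ block a → ∃ λ p → isPoint p ≡ true × z ≋ (a ⊙ p)
    ∈-block⁻ z∈ with ∈.∈-map⁻ (≋-setoid v) (≋-setoid v) z∈
    ... | p , p∈ , z≋ap = p , proj₂ (∈-filterᵇ⁻ isPoint-cong (allVecs v) p∈) , z≋ap
    separate : ∀ {a b z} → ¬ a ≈ 0# → ¬ b ≈ 0# → (∃ λ p → isPoint p ≡ true × z ≋ (a ⊙ p)) →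
               (∃ λ p → isPoint p ≡ true × z ≋ (b ⊙ p)) → a ≈ b
    separate a≉0 b≉0 (p , p-point , z≋ap) (p′ , p′-point , z≋bp′) =
      ⊙-point-injective p-point p′-point a≉0 b≉0 (≋-trans (≋-sym z≋ap) z≋bp′)
    sound : ∀ {z} → z ∈ nonzeroVecs v → nonzero z ≡ true
    sound {z} z∈ with findₛ (∈.∈-concatMap⁻ setoid (≋-setoid v) {xs = units} z∈)
    ... | a , a∈ , z∈a with ∈-block⁻ z∈a
    ...   | p , p-point , z≋ap = ≉0v⇒nonzero λ z≋0 →
      isPoint⇒≉0v p-point (⊙-cancel (∈-units⁻ a∈) (≋-trans (≋-sym z≋ap) z≋0))
    complete′ : ∀ {z} → nonzero z ≡ true → z ∈ nonzeroVecs v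
    complete′ {z} z≉0 with normalize z (nonzero⇒≉0v z≉0)
    ... | a , p , a≉0 , p-point , z≋ap =
      ∈.∈-concatMap⁺ setoid (≋-setoid v) (Any.map z∈block (∈-units⁺ a≉0))
      where
      z∈block : ∀ {b} → a ≈ b → z ∈ block b
      z∈block a≈b = ∈.∈-resp-≈ (≋-setoid v) (≋-trans (⊙-cong (sym a≈b) ≋-refl) (≋-sym z≋ap))
        (∈.∈-map⁺ (≋-setoid v) (≋-setoid v) (⊙-cong refl)
                  (∈-filterᵇ⁺ isPoint-cong (allVecs-complete v p) p-point))

  #vectors-scaleInvariant : ∀ {v P} → Congruent _≋_ _≡_ P → ScaleInvariant P → P 0v ≡ false →
                            #vectors v P ≡ #units * #points v P
  #vectors-scaleInvariant {v} {P} P-cong P-inv P0≡false = begin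
    #vectors v P
      ≡⟨ count-cong P≡nonzero∧P (allVecs v) ⟩
    count (λ x → nonzero x ∧ P x) (allVecs v)
      ≡⟨ count-enumeration (allVecs-unique v) (allVecs-complete v) nonzero-cong P-cong
                           (nonzeroVecs-enumerates v) ⟨
    count P (nonzeroVecs v)
      ≡⟨ count-concatMap P _ (All.tabulateₛ setoid (block ∘ ∈-units⁻)) ⟩
    #units * count P (points v)
      ≡⟨ ≡.cong (#units *_) (count-points v P) ⟩
    #units * #points v P
      ∎
    where
    open ≡-Reasoning
    P≡nonzero∧P : ∀ x → P x ≡ (nonzero x ∧ P x)
    P≡nonzero∧P x with PW.decidable _≟_ x (0v {v})
    ... | yes x≋0 = ≡.trans (P-cong x≋0) P0≡false
    ... | no _    = ≡.refl
    block : ∀ {a} → ¬ a ≈ 0# → count P (map (a ⊙_) (points v)) ≡ count P (points v)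
    block a≉0 = ≡.trans (count-map P _ (points v)) (count-cong (λ x → P-inv a≉0) (points v))

  HasDim-full : ∀ {v} (S : Subspace v) → HasDim S v → ∀ x → mem S x ≡ true
  HasDim-full {v} S hS x =
    All-∈ (resp S) (count≡length⇒All (mem S) (allVecs v) #S≡length) (allVecs-complete v x)
    where
    #S≡length : #vectors v (mem S) ≡ length (allVecs v)
    #S≡length = ≡.trans (#vectors-HasDim S hS) (≡.sym (length-allVecs v))

  module HyperplaneSection {v} (H : Subspace (suc v)) (hH : HasDim H v) {x₀} (x₀∉H : mem H x₀ ≡ false) where

    private
      b : Vec (V (suc v)) v
      b = proj₁ hH

      x₀∷b-independent : Independent (x₀ ∷ b)
      x₀∷b-independent = Independent-∷ {S = H} hH x₀∉H

      x₀∷b-spanning : ∀ w → mem (span (x₀ ∷ b)) w ≡ true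
      x₀∷b-spanning = HasDim-full (span (x₀ ∷ b)) (span-HasDim (x₀ ∷ b) x₀∷b-independent)

    decompose : ∀ w → ∃ λ d → ∃ λ h → mem H h ≡ true × w ≋ (h ⊕ (d ⊙ x₀))
    decompose w with ∈-combinations⁻ (x₀ ∷ b) (∈ᵇ⇒∈ (x₀∷b-spanning w))
    ... | d ∷ c , w≋ = d , lincomb c b , proj₁ (proj₂ hH) c , ≋-trans w≋ (⊕-comm _ _)

    decompose-unique : ∀ {d d′ h h′} → mem H h ≡ true → mem H h′ ≡ true →
                       (h ⊕ (d ⊙ x₀)) ≋ (h′ ⊕ (d′ ⊙ x₀)) → d ≈ d′
    decompose-unique {d} {d′} {h} {h′} h∈H h′∈H e =
      let c  , h≋  = proj₁ (proj₂ (proj₂ hH)) h h∈H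
          c′ , h′≋ = proj₁ (proj₂ (proj₂ hH)) h′ h′∈H
      in PW.head (lincomb-injective x₀∷b-independent {d ∷ c} {d′ ∷ c′}
           (≋-trans (⊕-comm _ _) (≋-trans (⊕-cong (≋-sym h≋) ≋-refl)
                                           (≋-trans e (≋-trans (⊕-cong h′≋ ≋-refl) (⊕-comm _ _))))))

    -- S is the disjoint union of the translates (S ∩ H) + d · x₀, one for each scalar d.
    #vectors-section : (S : Subspace (suc v)) → mem S x₀ ≡ true →
                       #vectors (suc v) (mem S) ≡ order * #vectors (suc v) (λ x → mem S x ∧ mem H x)
    #vectors-section S x₀∈S = begin
      #vectors (suc v) (mem S)
        ≡⟨ #vectors-enumeration (resp S) enum ⟩
      length (concatMap block elements)
        ≡⟨ count-true (concatMap block elements) ⟨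
      count (λ _ → true) (concatMap block elements)
        ≡⟨ count-concatMap _ block (universal block-size elements) ⟩
      order * #vectors (suc v) S∩H
        ∎
      where
      open ≡-Reasoning
      S∩H : V (suc v) → Bool
      S∩H x = mem S x ∧ mem H x
      S∩H-cong : Congruent _≋_ _≡_ S∩H
      S∩H-cong x≋y = ≡.cong₂ _∧_ (resp S x≋y) (resp H x≋y)
      block : Carrier → List (V (suc v))
      block d = map (_⊕ (d ⊙ x₀)) (filterᵇ S∩H (allVecs (suc v)))
      block-size : ∀ d → count (λ _ → true) (block d) ≡ #vectors (suc v) S∩H
      block-size d = ≡.trans (count-map _ _ (filterᵇ S∩H (allVecs (suc v))))
        (≡.trans (count-filterᵇ S∩H _ (allVecs (suc v)))
                 (count-cong (λ x → ∧-identityʳ (S∩H x)) (allVecs (suc v))))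
      ∈-block⁻ : ∀ {d z} → z ∈ block d → ∃ λ h → S∩H h ≡ true × z ≋ (h ⊕ (d ⊙ x₀))
      ∈-block⁻ z∈ with ∈.∈-map⁻ (≋-setoid (suc v)) (≋-setoid (suc v)) z∈
      ... | h , h∈ , z≋ = h , proj₂ (∈-filterᵇ⁻ S∩H-cong (allVecs (suc v)) h∈) , z≋
      separate : ∀ {a b z} → z ∈ block a → z ∈ block b → a ≈ b
      separate z∈a z∈b with ∈-block⁻ z∈a | ∈-block⁻ z∈b
      ... | h , h∈ , z≋ | h′ , h′∈ , z≋′ =
        decompose-unique (∧-conicalʳ _ _ h∈) (∧-conicalʳ _ _ h′∈) (≋-trans (≋-sym z≋) z≋′)
      sound : ∀ {z} → z ∈ concatMap block elements → mem S z ≡ true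
      sound z∈ with findₛ (∈.∈-concatMap⁻ setoid (≋-setoid (suc v)) {xs = elements} z∈)
      ... | d , _ , z∈d with ∈-block⁻ z∈d
      ...   | h , h∈ , z≋ = ≡.trans (resp S z≋) (+-closed S (∧-conicalˡ _ _ h∈) (·-closed S d x₀∈S))
      complete′ : ∀ {z} → mem S z ≡ true → z ∈ concatMap block elements
      complete′ {z} z∈S with decompose z
      ... | d , h , h∈H , z≋ = ∈.∈-concatMap⁺ setoid (≋-setoid (suc v)) (Any.map z∈block (complete d))
        where
        h∈S : mem S h ≡ true
        h∈S = ≡.trans (resp S (≋-trans (≋-sym (⊕⊖ h (d ⊙ x₀))) (⊕-cong (≋-sym z≋) ≋-refl)))
                      (+-closed S z∈S (·-closed S (- 1#) (·-closed S d x₀∈S)))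
        h∈S∩H : S∩H h ≡ true
        h∈S∩H rewrite h∈S | h∈H = ≡.refl
        z∈block : ∀ {d′} → d ≈ d′ → z ∈ block d′
        z∈block d≈d′ = ∈.∈-resp-≈ (≋-setoid (suc v))
          (≋-sym (≋-trans z≋ (⊕-cong ≋-refl (⊙-cong d≈d′ ≋-refl))))
          (∈.∈-map⁺ (≋-setoid (suc v)) (≋-setoid (suc v)) (λ e → ⊕-cong e ≋-refl)
                    (∈-filterᵇ⁺ S∩H-cong (allVecs-complete _ h) h∈S∩H))
      enum : Enumerates (mem S) (concatMap block elements)
      enum = record
        { unique   = Unique-concatMap {B = setoid} block distinct
            (λ _ → Unique.map⁺ (≋-setoid (suc v)) (≋-setoid (suc v)) (⊕-injectiveʳ _)
                               (filterᵇ-unique S∩H (allVecs-unique (suc v))))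
            (λ _ _ → separate)
        ; sound    = sound
        ; complete = complete′
        }

  #vectors-∣-⊆ : ∀ {v} {T S : Subspace v} → T ⊆ S → #vectors v (mem T) ∣ #vectors v (mem S)
  #vectors-∣-⊆ {T = T} {S} T⊆S =
    #vectors-∣-invariant T (resp S) (λ x∈S t∈T → +-closed S x∈S (T⊆S t∈T))

module Sunflowers (F : FiniteField) where

  open FiniteField F using (_≈_; 1≉0; _≟_; order)
  open Geometry F
  open VectorAlgebra F
  open VectorCounting F
  open Counting
  open Divisibility
  open import Algebra.Bundles using (CommutativeMonoid)
  open import Data.Bool.ListAction using (any)
  open import Data.Bool.Properties
    using ( ∧-zeroʳ; ∧-identityʳ; ∧-conicalˡ; ∧-conicalʳ; ∧-assoc; ∧-distribˡ-∨; ∧-distribʳ-∨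
          ; ∧-commutativeMonoid )
  open import Algebra.Properties.CommutativeSemigroup (CommutativeMonoid.commutativeSemigroup ∧-commutativeMonoid)
    using (xy∙z≈xz∙y)
  import Data.Integer as ℤ
  import Data.Integer.Divisibility as ℤ
  open import Data.List using (map; allFin)
  open import Data.List.Membership.Setoid.Properties using (∈-length)
  open import Data.List.Properties using (map-cong; length-tabulate)
  open import Data.List.Relation.Unary.All using (universal)
  open import Data.List.Relation.Unary.Unique.Propositional.Properties using (allFin⁺)
  open import Data.Nat using (_+_; _*_; _^_; _≤_; s≤s; z≤n; NonZero)
  open import Data.Nat.Coprimality using (Coprime; coprime-divisor)
  open import Data.Nat.Divisibility using (_∣_; _∣0; n∣m*n; ∣n⇒∣m*n; *-cancelˡ-∣; ∣m+n∣m⇒∣n)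
  open import Data.Nat.ListAction using (sum)
  open import Data.Nat.Properties using (+-cancelˡ-≡; *-zeroʳ; m≤n⇒m≤1+n)
  open import Data.Nat.Tactic.RingSolver using (solve-∀)
  open import Data.Vec.Relation.Binary.Pointwise.Inductive as PW using ()
  open import Function using (id)
  open import Relation.Nullary using (yes; no)

  infixl 7 _∖_ _∩_
  _∖_ : ∀ {v} → (V v → Bool) → Subspace v → V v → Bool
  (P ∖ S) x = P x ∧ not (mem S x)

  _∩_ : ∀ {v} → (V v → Bool) → Subspace v → V v → Bool
  (P ∩ S) x = P x ∧ mem S x

  ∖-cong : ∀ {v} {P : V v → Bool} (S : Subspace v) → Congruent _≋_ _≡_ P → Congruent _≋_ _≡_ (P ∖ S)
  ∖-cong S P-cong x≋y = ≡.cong₂ _∧_ (P-cong x≋y) (≡.cong not (resp S x≋y))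

  ∖-scaleInvariant : ∀ {v} {P : V v → Bool} (S : Subspace v) → ScaleInvariant P → ScaleInvariant (P ∖ S)
  ∖-scaleInvariant S P-inv a≉0 = ≡.cong₂ _∧_ (P-inv a≉0) (≡.cong not (mem-scaleInvariant S a≉0))

  ∖-0v : ∀ {v} (P : V v → Bool) (S : Subspace v) → (P ∖ S) 0v ≡ false
  ∖-0v P S rewrite zero∈ S = ∧-zeroʳ (P 0v)

  #vectors-∖ : ∀ {v} {P : V v → Bool} (S : Subspace v) → Congruent _≋_ _≡_ P → ScaleInvariant P →
               #vectors v (P ∖ S) ≡ #units * #points v (P ∖ S)
  #vectors-∖ {P = P} S P-cong P-inv =
    #vectors-scaleInvariant (∖-cong S P-cong) (∖-scaleInvariant {P = P} S P-inv) (∖-0v P S)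

  ⊆⊎escape : ∀ {v} (S T : Subspace v) → S ⊆ T ⊎ ∃ λ x → mem S x ≡ true × mem T x ≡ false
  ⊆⊎escape S T with all-false⊎witness (mem S ∖ T) (∖-cong T (resp S))
  ... | inj₁ none = inj₁ λ {x} x∈S → S⊆T x x∈S (none x)
    where
    S⊆T : ∀ x → mem S x ≡ true → (mem S ∖ T) x ≡ false → mem T x ≡ true
    S⊆T x x∈S x∉S∖T with mem T x
    ... | true  = ≡.refl
    ... | false = ⊥-elim (false≢true (≡.trans (≡.sym x∉S∖T) (≡.trans (∧-identityʳ (mem S x)) x∈S)))
  ... | inj₂ (x , x∈S∖T) = inj₂ (x , ∧-conicalˡ _ _ x∈S∖T , not-true (∧-conicalʳ _ _ x∈S∖T))
    where
    not-true : ∀ {b} → not b ≡ true → b ≡ false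
    not-true {false} _ = ≡.refl

  ∖-translationInvariant : ∀ {v} {S T H : Subspace v} → T ⊆ S → T ⊆ H →
                           TranslationInvariant T (mem S ∖ H)
  ∖-translationInvariant {S = S} {T} {H} T⊆S T⊆H {x} {t} x∈S∖H t∈T
    with mem S x in x∈S | mem H x in x∈H | mem H (x ⊕ t) in x+t∈H
  ... | true | false | false rewrite +-closed S x∈S (T⊆S t∈T) = ≡.refl
  ... | true | false | true  = ⊥-elim (false≢true (≡.trans (≡.sym x∈H)
        (≡.trans (resp H (≋-sym (⊕⊖ x t))) (+-closed H x+t∈H (·-closed H _ (T⊆H t∈T))))))

  another : ∀ {t} → 2 ≤ t → (i : Fin t) → ∃ λ j → i ≢ j
  another (s≤s (s≤s z≤n)) Fin.zero    = Fin.suc Fin.zero , λ ()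
  another (s≤s (s≤s z≤n)) (Fin.suc i) = Fin.zero , λ ()

  2≤order : 2 ≤ order
  2≤order =
    ≡.subst (2 ≤_) (≡.sym order≡1+#units) (s≤s (∈-length (FiniteField.setoid F) (∈-units⁺ 1≉0)))

  module Sunflower {v t} {Y : Fin t → Subspace v} {X : Subspace v} (sunflower : IsSunflower t Y X) (2≤t : 2 ≤ t)
    where

    petal : Fin t → V v → Bool
    petal i = mem (Y i) ∖ X

    -- The sunflower axioms only speak about points; scaling transfers them to all vectors.
    center⊆petal : ∀ i → X ⊆ Y i
    center⊆petal i {x} x∈X with PW.decidable _≟_ x (0v {v})
    ... | yes x≋0 = ≡.trans (resp (Y i) x≋0) (zero∈ (Y i))
    ... | no x≉0 with normalize x x≉0
    ...   | a , p , a≉0 , p-point , x≋ap =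
      ≡.trans (resp (Y i) x≋ap) (≡.trans (mem-scaleInvariant (Y i) a≉0) (∧-conicalˡ _ _ p∈Yi∩Yj))
      where
      j = proj₁ (another 2≤t i)
      p∈Yi∩Yj : (mem (Y i) p ∧ mem (Y j) p) ≡ true
      p∈Yi∩Yj = ≡.trans (proj₂ sunflower i j (proj₂ (another 2≤t i)) p p-point)
                  (≡.trans (≡.sym (mem-scaleInvariant X a≉0)) (≡.trans (≡.sym (resp X x≋ap)) x∈X))

    petal-escapes : ∀ i → ∃ λ y → mem (Y i) y ≡ true × mem X y ≡ false
    petal-escapes i with ⊆⊎escape (Y i) X
    ... | inj₂ y    = y
    ... | inj₁ Yi⊆X = ⊥-elim (proj₁ sunflower i λ p _ → same p)
      where
      same : ∀ p → mem (Y i) p ≡ mem X p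
      same p with mem (Y i) p in p∈Yi | mem X p in p∈X
      ... | true  | true  = ≡.refl
      ... | false | false = ≡.refl
      ... | true  | false = ≡.trans (≡.sym (Yi⊆X p∈Yi)) p∈X
      ... | false | true  = ≡.trans (≡.sym p∈Yi) (center⊆petal i p∈X)

    petals-disjoint : ∀ {i j} → i ≢ j → ∀ p → isPoint p ≡ true → (petal i p ∧ petal j p) ≡ false
    petals-disjoint {i} {j} i≢j p p-point with mem (Y i) p | mem (Y j) p | proj₂ sunflower i j i≢j p p-point
    ... | true  | true  | p∈X rewrite ≡.sym p∈X = ≡.refl
    ... | true  | false | p∉X rewrite ≡.sym p∉X = ≡.refl
    ... | false | _     | _                      = ≡.refl

    center-petals-disjoint : ∀ x → mem X x ≡ true → petals t Y X x ≡ false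
    center-petals-disjoint x x∈X =
      ≡.trans (≡.sym (∧-distribʳ-any (λ i → mem (Y i) x) (not (mem X x)) (allFin t)))
              (≡.trans (≡.cong (λ b → _ ∧ not b) x∈X) (∧-zeroʳ _))

  module _ {v} (H : Subspace (suc v)) (hH : HasDim H v) where

    private
      #V : (V (suc v) → Bool) → ℕ
      #V = #vectors (suc v)

      #P : (V (suc v) → Bool) → ℕ
      #P = #points (suc v)

    #∖H≡#units*#∩H : (S : Subspace (suc v)) {x₀ : V (suc v)} →
                     mem S x₀ ≡ true → mem H x₀ ≡ false → #V (mem S ∖ H) ≡ #units * #V (mem S ∩ H)
    #∖H≡#units*#∩H S x₀∈S x₀∉H = +-cancelˡ-≡ (#V (mem S ∩ H)) _ _ (begin
      #V (mem S ∩ H) + #V (mem S ∖ H)          ≡⟨ count-split (mem S) (mem H) (allVecs (suc v)) ⟨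
      #V (mem S)                               ≡⟨ #vectors-section S x₀∈S ⟩
      order * #V (mem S ∩ H)                   ≡⟨ ≡.cong (_* #V (mem S ∩ H)) order≡1+#units ⟩
      #V (mem S ∩ H) + #units * #V (mem S ∩ H) ∎)
      where
      open ≡-Reasoning
      open HyperplaneSection H hH x₀∉H

    module _ {r} (X : Subspace (suc v)) (hX : HasDim X r) where

      order^r∣#∖H : (Y : Subspace (suc v)) → X ⊆ Y → ∀ {y} → mem Y y ≡ true → mem X y ≡ false →
                    order ^ r ∣ #V (mem Y ∖ H)
      order^r∣#∖H Y X⊆Y {y} y∈Y y∉X with ⊆⊎escape X H
      ... | inj₁ X⊆H = ≡.subst (_∣ _) (#vectors-HasDim X hX)
        (#vectors-∣-invariant X (∖-cong H (resp Y)) (∖-translationInvariant {S = Y} {X} {H} X⊆Y X⊆H))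
      ... | inj₂ (x₀ , x₀∈X , x₀∉H) =
        ≡.subst (order ^ r ∣_) (≡.sym (#∖H≡#units*#∩H Y (X⊆Y x₀∈X) x₀∉H))
                (∣n⇒∣m*n #units (*-cancelˡ-∣ order order^[1+r]∣order*#Y∩H))
        where
        open HyperplaneSection H hH x₀∉H
        instance
          order-nonZero : NonZero order
          order-nonZero = ≡.subst NonZero (≡.sym order≡1+#units) _
        y∷b : Vec (V (suc v)) (suc r)
        y∷b = y ∷ proj₁ hX
        span⊆Y : span y∷b ⊆ Y
        span⊆Y = span-⊆ Y {y∷b} λ { (d ∷ c) → +-closed Y (·-closed Y d y∈Y) (X⊆Y (proj₁ (proj₂ hX) c)) }
        #span≡order^[1+r] : #V (mem (span y∷b)) ≡ order ^ suc r
        #span≡order^[1+r] = #vectors-HasDim (span y∷b) (span-HasDim y∷b (Independent-∷ {S = X} hX y∉X))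
        order^[1+r]∣#Y : order ^ suc r ∣ #V (mem Y)
        order^[1+r]∣#Y = ≡.subst (_∣ _) #span≡order^[1+r] (#vectors-∣-⊆ {T = span y∷b} {S = Y} span⊆Y)
        order^[1+r]∣order*#Y∩H : order * order ^ r ∣ order * #V (mem Y ∩ H)
        order^[1+r]∣order*#Y∩H = ≡.subst (_ ∣_) (#vectors-section Y (X⊆Y x₀∈X)) order^[1+r]∣#Y

      order^r∣order*#center∖H : order ^ r ∣ order * #V (mem X ∖ H)
      order^r∣order*#center∖H with ⊆⊎escape X H
      ... | inj₁ X⊆H = ≡.subst (λ n → order ^ r ∣ order * n) (≡.sym #X∖H≡0)
                               (≡.subst (order ^ r ∣_) (≡.sym (*-zeroʳ order)) (_ ∣0))
        where
        #X∖H≡0 : #V (mem X ∖ H) ≡ 0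
        #X∖H≡0 = count-none _ (allVecs (suc v)) (universal outside (allVecs (suc v)))
          where
          outside : ∀ x → (mem X ∖ H) x ≡ false
          outside x with mem X x in x∈X
          ... | false = ≡.refl
          ... | true rewrite X⊆H x∈X = ≡.refl
      ... | inj₂ (x₀ , x₀∈X , x₀∉H) = ≡.subst (order ^ r ∣_) (≡.sym order*#X∖H) (n∣m*n #units)
        where
        open HyperplaneSection H hH x₀∉H
        order*#X∖H : order * #V (mem X ∖ H) ≡ #units * order ^ r
        order*#X∖H = begin
          order * #V (mem X ∖ H)            ≡⟨ ≡.cong (order *_) (#∖H≡#units*#∩H X x₀∈X x₀∉H) ⟩
          order * (#units * #V (mem X ∩ H)) ≡⟨ swap order #units _ ⟩
          #units * (order * #V (mem X ∩ H)) ≡⟨ ≡.cong (#units *_) (#vectors-section X x₀∈X) ⟨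
          #units * #V (mem X)               ≡⟨ ≡.cong (#units *_) (#vectors-HasDim X hX) ⟩
          #units * order ^ r                ∎
          where
          open ≡-Reasoning
          swap : ∀ a b c → a * (b * c) ≡ b * (a * c)
          swap = solve-∀

      module Petals {t} {Y : Fin t → Subspace (suc v)} (sunflower : IsSunflower t Y X) (2≤t : 2 ≤ t) where

        open Sunflower {Y = Y} {X} sunflower 2≤t

        #petal∖H : ∀ i → #V (mem (Y i) ∖ H) ≡ #V (mem X ∖ H) + #units * #P (petal i ∖ H)
        #petal∖H i = begin
          #V (mem (Y i) ∖ H)
            ≡⟨ count-split (mem (Y i) ∖ H) (mem X) (allVecs (suc v)) ⟩
          #V (λ x → (mem (Y i) ∖ H) x ∧ mem X x) + #V (λ x → (mem (Y i) ∖ H) x ∧ not (mem X x))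
            ≡⟨ ≡.cong₂ _+_ (count-cong center (allVecs (suc v)))
                           (count-cong (λ x → xy∙z≈xz∙y (mem (Y i) x) _ _) (allVecs (suc v))) ⟩
          #V (mem X ∖ H) + #V (petal i ∖ H)
            ≡⟨ ≡.cong (#V (mem X ∖ H) +_) (#vectors-∖ H (∖-cong X (resp (Y i))) petal-scaleInvariant) ⟩
          #V (mem X ∖ H) + #units * #P (petal i ∖ H)
            ∎
          where
          open ≡-Reasoning
          petal-scaleInvariant : ScaleInvariant (petal i)
          petal-scaleInvariant = ∖-scaleInvariant {P = mem (Y i)} X (mem-scaleInvariant (Y i))
          center : ∀ x → ((mem (Y i) ∖ H) x ∧ mem X x) ≡ (mem X ∖ H) x
          center x with mem X x in x∈X
          ... | false = ∧-zeroʳ _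
          ... | true rewrite center⊆petal i x∈X = ∧-identityʳ _

        #petals∖H : #P (petals t Y X ∖ H) ≡ sum (map (λ i → #P (petal i ∖ H)) (allFin t))
        #petals∖H = begin
          #P (petals t Y X ∖ H)
            ≡⟨ #points≡count (suc v) _ ⟩
          count (λ x → isPoint x ∧ (petals t Y X ∖ H) x) (allVecs (suc v))
            ≡⟨ count-cong distribute (allVecs (suc v)) ⟩
          count (λ x → any (λ i → pointOf i x) (allFin t)) (allVecs (suc v))
            ≡⟨ count-any pointOf (allFin t) (allFin⁺ t) disjoint (allVecs (suc v)) ⟩
          sum (map (λ i → count (pointOf i) (allVecs (suc v))) (allFin t))
            ≡⟨ ≡.cong sum (map-cong (λ i → ≡.sym (#points≡count (suc v) (petal i ∖ H))) (allFin t)) ⟩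
          sum (map (λ i → #P (petal i ∖ H)) (allFin t))
            ∎
          where
          open ≡-Reasoning
          pointOf : Fin t → V (suc v) → Bool
          pointOf i x = isPoint x ∧ (petal i ∖ H) x
          distribute : ∀ x → (isPoint x ∧ (petals t Y X ∖ H) x) ≡ any (λ i → pointOf i x) (allFin t)
          distribute x = ≡.trans (≡.cong (isPoint x ∧_) (∧-distribʳ-any (λ i → petal i x) _ (allFin t)))
                                 (∧-distribˡ-any (λ i → (petal i ∖ H) x) (isPoint x) (allFin t))
          disjoint : ∀ {i j} → i ≢ j → ∀ x → (pointOf i x ∧ pointOf j x) ≡ false
          disjoint {i} {j} i≢j x with isPoint x in x-point | petal i x in x∈i | petal j x in x∈j
          ... | false | _     | _     = ≡.refl
          ... | true  | false | _     = ≡.refl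
          ... | true  | true  | false = ∧-zeroʳ _
          ... | true  | true  | true  =
            ⊥-elim (false≢true (≡.trans (≡.sym (petals-disjoint i≢j x x-point))
                                        (≡.cong₂ _∧_ x∈i x∈j)))

        order^r∣Σ : order ^ r ∣ t * #V (mem X ∖ H) + #units * #P (petals t Y X ∖ H)
        order^r∣Σ = ≡.subst (order ^ r ∣_) Σ≡ (∣-sum _ (allFin t) λ i →
          let _ , y∈Yi , y∉X = petal-escapes i in order^r∣#∖H (Y i) (center⊆petal i) y∈Yi y∉X)
          where
          Σ≡ : sum (map (λ i → #V (mem (Y i) ∖ H)) (allFin t)) ≡
               t * #V (mem X ∖ H) + #units * #P (petals t Y X ∖ H)
          Σ≡ = ≡.trans (sum-map-affine _ #units _ _ (allFin t) #petal∖H)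
                       (≡.cong₂ (λ n m → n * #V (mem X ∖ H) + #units * m)
                                (length-tabulate {n = t} id) (≡.sym #petals∖H))

        #center∪petals∖H : #P (petalsAndCenter t Y X ∖ H) ≡ #P (mem X ∖ H) + #P (petals t Y X ∖ H)
        #center∪petals∖H = begin
          #P (petalsAndCenter t Y X ∖ H)
            ≡⟨ #points≡count (suc v) _ ⟩
          count (λ x → isPoint x ∧ (petalsAndCenter t Y X ∖ H) x) (allVecs (suc v))
            ≡⟨ count-cong distribute (allVecs (suc v)) ⟩
          count (λ x → pointOfX x ∨ pointOfPetals x) (allVecs (suc v))
            ≡⟨ count-∨ _ _ (allVecs (suc v)) disjoint ⟩
          count pointOfX (allVecs (suc v)) + count pointOfPetals (allVecs (suc v))
            ≡⟨ ≡.cong₂ _+_ (≡.sym (#points≡count (suc v) _)) (≡.sym (#points≡count (suc v) _)) ⟩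
          #P (mem X ∖ H) + #P (petals t Y X ∖ H)
            ∎
          where
          open ≡-Reasoning
          pointOfX pointOfPetals : V (suc v) → Bool
          pointOfX      x = isPoint x ∧ (mem X ∖ H) x
          pointOfPetals x = isPoint x ∧ (petals t Y X ∖ H) x
          distribute : ∀ x → (isPoint x ∧ (petalsAndCenter t Y X ∖ H) x) ≡ (pointOfX x ∨ pointOfPetals x)
          distribute x =
            ≡.trans (≡.cong (isPoint x ∧_) (∧-distribʳ-∨ _ (mem X x) _)) (∧-distribˡ-∨ (isPoint x) _ _)
          disjoint : ∀ x → (pointOfX x ∧ pointOfPetals x) ≡ false
          disjoint x = exclusive (isPoint x) (mem X x) _ _ (center-petals-disjoint x)
            where
            exclusive : ∀ p a b h → (a ≡ true → b ≡ false) →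
                        ((p ∧ (a ∧ h)) ∧ (p ∧ (b ∧ h))) ≡ false
            exclusive false _     _ _ _    = ≡.refl
            exclusive true  false _ _ _    = ≡.refl
            exclusive true  true  b h a⇒¬b rewrite a⇒¬b ≡.refl = ∧-zeroʳ h

      private
        order^r⊥#units : Coprime (order ^ r) #units
        order^r⊥#units =
          coprime-^ˡ r (≡.subst (λ n → Coprime n #units) (≡.sym order≡1+#units) (coprime-suc #units))

      order^r∣#petals∖H : ∀ {Y : Fin order → Subspace (suc v)} → IsSunflower order Y X →
                          order ^ r ∣ #P (petals order Y X ∖ H)
      order^r∣#petals∖H {Y} sunflower =
        coprime-divisor order^r⊥#units (∣m+n∣m⇒∣n order^r∣Σ order^r∣order*#center∖H)
        where open Petals {Y = Y} sunflower 2≤order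

      order^r∣#petalsAndCenter∖H : ∀ {Y : Fin (suc order) → Subspace (suc v)} →
                                   IsSunflower (suc order) Y X →
                                   order ^ r ∣ #P (petalsAndCenter (suc order) Y X ∖ H)
      order^r∣#petalsAndCenter∖H {Y} sunflower = ≡.subst (order ^ r ∣_) (≡.sym #center∪petals∖H)
        (coprime-divisor order^r⊥#units
          (∣m+n∣m⇒∣n (≡.subst (order ^ r ∣_) regroup order^r∣Σ) order^r∣order*#center∖H))
        where
        open Petals {Y = Y} sunflower (m≤n⇒m≤1+n 2≤order)
        regroup : suc order * #V (mem X ∖ H) + #units * #P (petals (suc order) Y X ∖ H) ≡
                  order * #V (mem X ∖ H) + #units * (#P (mem X ∖ H) + #P (petals (suc order) Y X ∖ H))
        regroup rewrite #vectors-∖ {P = mem X} H (resp X) (mem-scaleInvariant X) = shuffle order #units _ _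
          where
          shuffle : ∀ q u a c → suc q * (u * a) + u * c ≡ q * (u * a) + u * (a + c)
          shuffle = solve-∀

  #points-∩+∖ : ∀ {v} (Q : V v → Bool) (H : Subspace v) →
                #points v Q ≡ #points v (Q ∩ H) + #points v (Q ∖ H)
  #points-∩+∖ {v} Q H = begin
    #points v Q
      ≡⟨ #points≡count v Q ⟩
    count (λ x → isPoint x ∧ Q x) (allVecs v)
      ≡⟨ count-split _ (mem H) (allVecs v) ⟩
    count (λ x → (isPoint x ∧ Q x) ∧ mem H x) (allVecs v) +
    count (λ x → (isPoint x ∧ Q x) ∧ not (mem H x)) (allVecs v)
      ≡⟨ ≡.cong₂ _+_ (count-cong (λ x → ∧-assoc (isPoint x) _ _) (allVecs v))
                     (count-cong (λ x → ∧-assoc (isPoint x) _ _) (allVecs v)) ⟩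
    count (λ x → isPoint x ∧ (Q ∩ H) x) (allVecs v) + count (λ x → isPoint x ∧ (Q ∖ H) x) (allVecs v)
      ≡⟨ ≡.cong₂ _+_ (≡.sym (#points≡count v _)) (≡.sym (#points≡count v _)) ⟩
    #points v (Q ∩ H) + #points v (Q ∖ H)
      ∎
    where open ≡-Reasoning

  #points-∩≡#points-mod : ∀ {v d} (Q : V v → Bool) (H : Subspace v) → d ∣ #points v (Q ∖ H) →
                          ℤ.+ d ℤ.∣ (ℤ.+ #points v (Q ∩ H) ℤ.- ℤ.+ #points v Q)
  #points-∩≡#points-mod {v} Q H d∣ rewrite #points-∩+∖ Q H = ∣[+m]-[+[m+n]] (#points v (Q ∩ H)) d∣

open import Data.Nat using (_≤_; _^_; s≤s; z≤n)
open import Data.Integer using (+_; _-_)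
open import Data.Integer.Divisibility using (_∣_)
open import Relation.Binary.PropositionalEquality using (refl)

lemma16 : (F : FiniteField) → let open Geometry F in
    (q v r : ℕ) → FiniteField.order F ≡ q → 1 ≤ v →
      ((Y : Fin q → Subspace v) (X : Subspace v) → HasDim X r → IsSunflower q Y X →
        (H : Subspace v) → IsHyperplane H →
        (+ (q ^ r)) ∣ (+ #points v (λ p → petals q Y X p ∧ mem H p) - + #points v (petals q Y X)))
    × ((Y : Fin (suc q) → Subspace v) (X : Subspace v) → HasDim X r → IsSunflower (suc q) Y X →
        (H : Subspace v) → IsHyperplane H →
        (+ (q ^ r)) ∣ (+ #points v (λ p → petalsAndCenter (suc q) Y X p ∧ mem H p) - + #points v (petalsAndCenter (suc q) Y X)))
lemma16 F _ (suc v) r refl (s≤s z≤n) =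
    (λ Y X hX sunflower H hH →
       #points-∩≡#points-mod (petals _ Y X) H (order^r∣#petals∖H H hH X hX {Y} sunflower))
  , (λ Y X hX sunflower H hH →
       #points-∩≡#points-mod (petalsAndCenter _ Y X) H (order^r∣#petalsAndCenter∖H H hH X hX {Y} sunflower))
  where
  open Geometry F
  open Sunflowers F
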